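{- Let $\{D_1,\dots,D_m\}$ be a nontrivial $(v,m,k,\lambda)$-SEDF in a finite abelian group $G$ with $m>2$, let $D=\bigcup_{i=1}^mD_i$, and for $\chi\in\widehat{G}^N$ let $a_\chi,b_\chi$ be as defined in the context. Then for each $\chi\in\widehat{G}^N$: (1) $2b_\chi\mid b_\chi m-a_\chi(m-2)$, and $b_\chi\mid m-2$; (2) $(b_\chi-a_\chi)\mid(b_\chi+a_\chi)\lambda$, and $(b_\chi+a_\chi)\mid(b_\chi-a_\chi)\lambda$; (3) $(b_\chi^2-a_\chi^2)\mid 4\lambda$, and if $b_\chi+a_\chi$ is odd then $(b_\chi^2-a_\chi^2)\mid\lambda$.
   Context: Groups are finite abelian, written multiplicatively with identity $1$. For a subset $A\subseteq G$ we also write $A$ for $\sum_{a\in A}a\in\mathbb{Z}[G]$ and $A^{(-1)}=\sum_{a\in A}a^{ -1}$. Given integers $m\ge 2$, $k\ge1$, $\lambda\ge 1$ and a group $G$ of order $v$, a collection $\{D_1,\dots,D_m\}$ of mutually disjoint $k$-subsets of $G$ is a $(v,m,k,\lambda)$-SEDF in $G$ if $D_j\sum_{i\ne j}D_i^{(-1)}=\lambda(G-1)$ in $\mathbb{Z}[G]$ for each $j$; it is nontrivial if $k>1$. $\widehat{G}$ is the group of characters (homomorphisms $G\to\mathbb{C}^*$), extended linearly to $\mathbb{Z}[G]$. With $D=\bigcup_iD_i$, $\widehat{G}^N$ is the set of nonprincipal $\chi\in\widehat{G}$ with $\chi(D)\ne0$. For a nontrivial SEDF with $m>2$ and each $\chi\in\widehat{G}^N$,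 the number $\sqrt{1+4\lambda/|\chi(D)|^2}$ is rational; write it as $b_\chi/a_\chi$ with integers $b_\chi>a_\chi>0$ and $\gcd(a_\chi,b_\chi)=1$. -}

module Defs where

open import Level using (0ℓ)
open import Data.Nat using (ℕ; zero; suc; _≤_)
open import Data.Fin using (Fin)
import Data.Fin as Fin
open import Data.Bool using (if_then_else_)
open import Data.Product using (_×_; _,_; proj₁; proj₂; ∃)
open import Data.Sum using (_⊎_)
open import Data.List using (List; []; _∷_; length; filter; concatMap; map; allFin; cartesianProduct; foldr)
open import Data.List.Membership.Propositional using (_∈_; _∉_)
open import Data.List.Relation.Unary.Unique.Propositional using (Unique)
open import Relation.Binary.PropositionalEquality using (_≡_; _≢_)
open import Relation.Binary.Definitions using (DecidableEquality)
open import Relation.Nullary using (¬_)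
open import Relation.Nullary.Decidable using (⌊_⌋)
open import Function.Bundles using (_↔_)
open import Algebra.Structures using (IsAbelianGroup)
open import Algebra.Bundles using (CommutativeRing)

record FinAbGroup : Set₁ where
  field
    Carrier        : Set
    _∙_            : Carrier → Carrier → Carrier
    ε              : Carrier
    _⁻¹            : Carrier → Carrier
    isAbelianGroup : IsAbelianGroup _≡_ _∙_ ε _⁻¹
    _≟_            : DecidableEquality Carrier
    order          : ℕ
    enum           : Fin order ↔ Carrier

module _ (G : FinAbGroup) where
  open FinAbGroup G

  crossPairs : (m : ℕ) → (Fin m → List Carrier) → Fin m → List (Carrier × Carrier)
  crossPairs m D j =
    concatMap (λ i → if ⌊ i Fin.≟ j ⌋ then [] else cartesianProduct (D j) (D i)) (allFin m)

  -- coefficient of g in the group-ring element D_j Σ_{i≠j} D_i^{(-1)}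
  coeff : (m : ℕ) → (Fin m → List Carrier) → Fin m → Carrier → ℕ
  coeff m D j g = length (filter (λ p → (proj₁ p ∙ (proj₂ p ⁻¹)) ≟ g) (crossPairs m D j))

  -- {D_1,…,D_m} (subsets given as duplicate-free lists) is a (v,m,k,lam)-SEDF in G, v = order.
  -- The group ring identity D_j Σ_{i≠j} D_i^{(-1)} = lam (G - 1) is stated coefficientwise.
  record IsSEDF (m k lam : ℕ) (D : Fin m → List Carrier) : Set where
    field
      m≥2      : 2 ≤ m
      k≥1      : 1 ≤ k
      lam≥1    : 1 ≤ lam
      unique   : ∀ i → Unique (D i)
      size     : ∀ i → length (D i) ≡ k
      disjoint : ∀ i j → i ≢ j → ∀ x → x ∈ D i → x ∉ D j
      equation : ∀ j g → coeff m D j g ≡ (if ⌊ g ≟ ε ⌋ then 0 else lam)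

  union : (m : ℕ) → (Fin m → List Carrier) → List Carrier
  union m D = concatMap D (allFin m)

module _ (R : CommutativeRing 0ℓ 0ℓ) where
  open CommutativeRing R

  fromℕ : ℕ → Carrier
  fromℕ zero    = 0#
  fromℕ (suc n) = 1# + fromℕ n

  -- R is an integral domain of characteristic 0 (stand-in for ℂ)
  record IsChar0Domain : Set where
    field
      nontrivial : ¬ (1# ≈ 0#)
      noZeroDiv  : ∀ x y → x * y ≈ 0# → (x ≈ 0#) ⊎ (y ≈ 0#)
      char0      : ∀ n → fromℕ n ≈ 0# → n ≡ 0

module _ (G : FinAbGroup) (R : CommutativeRing 0ℓ 0ℓ) where
  open FinAbGroup G renaming (Carrier to GC)
  open CommutativeRing R

  record IsCharacter (χ : GC → Carrier) : Set where
    field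
      χ-ε : χ ε ≈ 1#
      χ-∙ : ∀ x y → χ (x ∙ y) ≈ χ x * χ y

  Nonprincipal : (GC → Carrier) → Set
  Nonprincipal χ = ∃ λ g → ¬ (χ g ≈ 1#)

  χsum : (GC → Carrier) → List GC → Carrier
  χsum χ xs = foldr (λ x acc → χ x + acc) 0# xs

  χsumInv : (GC → Carrier) → List GC → Carrier
  χsumInv χ xs = χsum χ (map _⁻¹ xs)

  -- |χ(A)|² = χ(A) · conj χ(A) = χ(A) χ(A^{(-1)})
  normSq : (GC → Carrier) → List GC → Carrier
  normSq χ xs = χsum χ xs * χsumInv χ xs

-- Write x_j = χ(D_j), y_j = χ(D_j^(-1)), S = Σ x_j and T = Σ y_j, so that |χ(D)|² = ST.
-- Applying χ to the SEDF equations gives x_j (T - y_j) = -λ = y_j (S - x_j); together with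
-- b² ST = a² (ST + 4λ) this forces a (2 x_j - S) = ± b S for every j. The sign decides between
-- (b - a) x_j y_j = (b + a) λ and (b + a) x_j y_j = (b - a) λ. Since x_j y_j lies in the ℤ-span of
-- the character values, a subring that is a finitely generated ℤ-module, a relation q x_j y_j = p
-- forces q ∣ p (by a Nakayama-type elimination). Summing the signs gives (2 - m) a = (n₊ - n₋) b,
-- which yields (1) and shows that both signs occur, whence (2); and (3) follows from (2) because
-- every common divisor of b - a and b + a divides 2.

module Submission where

open import Level using (0ℓ)
open import Algebra.Bundles using (CommutativeRing; AbelianGroup)
open import Algebra.Solver.Ring.AlmostCommutativeRing using (fromCommutativeRing; _-Raw-AlmostCommutative⟶_)
open import Data.Nat as ℕ using (ℕ; zero; suc; _≤_)
import Data.Nat.Properties as ℕ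
open import Data.Nat.DivMod using (_/_; m/n*n≡m)
open import Data.Nat.Divisibility using (_∣_)
open import Data.Nat.GCD using (gcd; gcd[m,n]∣m; gcd[m,n]∣n; gcd[m,n]≡0⇒m≡0; module Bézout)
open import Data.Nat.Coprimality using (Coprime; coprime-/gcd; coprime-Bézout)
open import Data.Integer as ℤ using (ℤ; -[1+_])
import Data.Integer.Properties as ℤ
open import Data.Sign as Sign using (Sign)
open import Data.Fin as Fin using (Fin; zero; suc)
import Data.Fin.Properties as Fin
open import Data.List using (List; []; _∷_; _++_; foldr; map; concatMap; tabulate; allFin; cartesianProduct; filter; length)
open import Data.Product using (Σ-syntax; _×_; _,_; proj₁; proj₂)
open import Data.Sum using (_⊎_; inj₁; inj₂)
open import Data.Bool using (Bool; true; false; if_then_else_; not)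
open import Data.Bool.Properties using (not-injective)
open import Data.Maybe using (Maybe; just; nothing)
open import Data.Empty using (⊥; ⊥-elim)
open import Function using (_∘_; Inverse; _↔_; mk↔ₛ′)
open import Relation.Nullary using (¬_; Dec; yes; no)
open import Relation.Nullary.Decidable using (⌊_⌋)
open import Relation.Binary.PropositionalEquality as ≡ using (_≡_; _≢_)
open import Defs

-- Integers in a commutative ring

module IntegerImage (R : CommutativeRing 0ℓ 0ℓ) where
  open CommutativeRing R
  open import Algebra.Properties.Ring ring using (-‿involutive; -0#≈0#; -‿distribˡ-*; -‿distribʳ-*; -‿+-comm)
  open import Algebra.Properties.Semiring.Mult semiring using (×-homo-+; ×1-homo-*) renaming (_×_ to _×′_)
  open import Relation.Binary.Reasoning.Setoid setoid

  ι : ℕ → Carrier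
  ι = fromℕ R

  ι≡×1# : ∀ n → ι n ≡ n ×′ 1#
  ι≡×1# zero    = ≡.refl
  ι≡×1# (suc n) = ≡.cong (1# +_) (ι≡×1# n)

  ι-homo-+ : ∀ m n → ι (m ℕ.+ n) ≈ ι m + ι n
  ι-homo-+ m n rewrite ι≡×1# m | ι≡×1# n | ι≡×1# (m ℕ.+ n) = ×-homo-+ 1# m n

  ι-homo-* : ∀ m n → ι (m ℕ.* n) ≈ ι m * ι n
  ι-homo-* m n rewrite ι≡×1# m | ι≡×1# n | ι≡×1# (m ℕ.* n) = ×1-homo-* m n

  signed : Sign → Carrier → Carrier
  signed Sign.+ x = x
  signed Sign.- x = - x

  signed-cong : ∀ s {x y} → x ≈ y → signed s x ≈ signed s y
  signed-cong Sign.+ e = e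
  signed-cong Sign.- e = -‿cong e

  signed-* : ∀ s t x y → signed (s Sign.* t) (x * y) ≈ signed s x * signed t y
  signed-* Sign.+ Sign.+ x y = refl
  signed-* Sign.+ Sign.- x y = -‿distribʳ-* x y
  signed-* Sign.- Sign.+ x y = -‿distribˡ-* x y
  signed-* Sign.- Sign.- x y = begin
    x * y             ≈⟨ -‿involutive _ ⟨
    - - (x * y)       ≈⟨ -‿cong (-‿distribˡ-* x y) ⟩
    - ((- x) * y)     ≈⟨ -‿distribʳ-* (- x) y ⟩
    (- x) * (- y)     ∎

  ιℤ : ℤ → Carrier
  ιℤ i = signed (ℤ.sign i) (ι ℤ.∣ i ∣)

  ιℤ-◃ : ∀ s n → ιℤ (s ℤ.◃ n) ≈ signed s (ι n)
  ιℤ-◃ Sign.+ zero    = refl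
  ιℤ-◃ Sign.- zero    = sym -0#≈0#
  ιℤ-◃ Sign.+ (suc n) = refl
  ιℤ-◃ Sign.- (suc n) = refl

  ιℤ-homo-* : ∀ i j → ιℤ (i ℤ.* j) ≈ ιℤ i * ιℤ j
  ιℤ-homo-* i j = begin
    ιℤ (i ℤ.* j)                                       ≈⟨ ιℤ-◃ (ℤ.sign i Sign.* ℤ.sign j) (ℤ.∣ i ∣ ℕ.* ℤ.∣ j ∣) ⟩
    signed (ℤ.sign i Sign.* ℤ.sign j) (ι (ℤ.∣ i ∣ ℕ.* ℤ.∣ j ∣)) ≈⟨ signed-cong (ℤ.sign i Sign.* ℤ.sign j) (ι-homo-* ℤ.∣ i ∣ ℤ.∣ j ∣) ⟩
    signed (ℤ.sign i Sign.* ℤ.sign j) (ι ℤ.∣ i ∣ * ι ℤ.∣ j ∣) ≈⟨ signed-* (ℤ.sign i) (ℤ.sign j) _ _ ⟩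
    ιℤ i * ιℤ j                                        ∎

  ιℤ-⊖ : ∀ m n → ιℤ (m ℤ.⊖ n) ≈ ι m - ι n
  ιℤ-⊖ m       zero    = sym (trans (+-congˡ -0#≈0#) (+-identityʳ _))
  ιℤ-⊖ zero    (suc n) = sym (+-identityˡ _)
  ιℤ-⊖ (suc m) (suc n) = begin
    ιℤ (suc m ℤ.⊖ suc n)      ≡⟨ ≡.cong ιℤ (ℤ.[1+m]⊖[1+n]≡m⊖n m n) ⟩
    ιℤ (m ℤ.⊖ n)              ≈⟨ ιℤ-⊖ m n ⟩
    ι m - ι n                 ≈⟨ +-identityˡ _ ⟨
    0# + (ι m - ι n)          ≈⟨ +-congʳ (-‿inverseʳ 1#) ⟨
    (1# - 1#) + (ι m - ι n)   ≈⟨ shift 1# (ι m) (ι n) ⟩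
    (1# + ι m) - (1# + ι n)   ∎
    where
    shift : ∀ a x y → (a - a) + (x - y) ≈ (a + x) - (a + y)
    shift a x y = begin
      (a - a) + (x - y)     ≈⟨ +-assoc a (- a) (x - y) ⟩
      a + (- a + (x - y))   ≈⟨ +-congˡ (+-assoc (- a) x (- y)) ⟨
      a + ((- a + x) - y)   ≈⟨ +-congˡ (+-congʳ (+-comm (- a) x)) ⟩
      a + ((x - a) - y)     ≈⟨ +-congˡ (+-assoc x (- a) (- y)) ⟩
      a + (x + (- a - y))   ≈⟨ +-assoc a x _ ⟨
      (a + x) + (- a - y)   ≈⟨ +-congˡ (-‿+-comm a y) ⟩
      (a + x) - (a + y)     ∎

  ιℤ-homo-+ : ∀ i j → ιℤ (i ℤ.+ j) ≈ ιℤ i + ιℤ j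
  ιℤ-homo-+ (ℤ.+ m)  (ℤ.+ n)  = ι-homo-+ m n
  ιℤ-homo-+ (ℤ.+ m)  -[1+ n ] = ιℤ-⊖ m (suc n)
  ιℤ-homo-+ -[1+ m ] (ℤ.+ n)  = trans (ιℤ-⊖ n (suc m)) (+-comm _ _)
  ιℤ-homo-+ -[1+ m ] -[1+ n ] = begin
    - (1# + ι (suc m ℕ.+ n))          ≈⟨ -‿cong (+-congˡ (ι-homo-+ (suc m) n)) ⟩
    - (1# + ((1# + ι m) + ι n))       ≈⟨ -‿cong (exchange 1# (1# + ι m) (ι n)) ⟩
    - ((1# + ι m) + (1# + ι n))       ≈⟨ -‿+-comm _ _ ⟨
    - (1# + ι m) - (1# + ι n)         ∎
    where
    exchange : ∀ a x y → a + (x + y) ≈ x + (a + y)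
    exchange a x y = trans (sym (+-assoc a x y)) (trans (+-congʳ (+-comm a x)) (+-assoc x a y))

  ιℤ-homo-neg : ∀ i → ιℤ (ℤ.- i) ≈ - ιℤ i
  ιℤ-homo-neg (ℤ.+ zero)  = sym -0#≈0#
  ιℤ-homo-neg (ℤ.+ suc n) = refl
  ιℤ-homo-neg -[1+ n ]    = sym (-‿involutive _)

  ιℤ-homomorphism : ℤ.+-*-rawRing -Raw-AlmostCommutative⟶ fromCommutativeRing R
  ιℤ-homomorphism = record
    { ⟦_⟧    = ιℤ
    ; +-homo = ιℤ-homo-+
    ; *-homo = ιℤ-homo-*
    ; -‿homo = ιℤ-homo-neg
    ; 0-homo = refl
    ; 1-homo = +-identityʳ 1#
    }

  ≟-ιℤ : ∀ i j → Maybe (ιℤ i ≈ ιℤ j)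
  ≟-ιℤ i j with i ℤ.≟ j
  ... | yes ≡.refl = just refl
  ... | no _       = nothing

  open import Algebra.Solver.Ring ℤ.+-*-rawRing (fromCommutativeRing R) ιℤ-homomorphism ≟-ιℤ public

module CharacteristicZeroDomain (R : CommutativeRing 0ℓ 0ℓ) (domain : IsChar0Domain R) where
  open CommutativeRing R
  open IsChar0Domain domain
  open IntegerImage R
  open import Algebra.Properties.Group +-group public
    using () renaming (x∙y⁻¹≈ε⇒x≈y to x-y≈0⇒x≈y; x≈y⇒x∙y⁻¹≈ε to x≈y⇒x-y≈0)
  open import Relation.Binary.Reasoning.Setoid setoid

  cancelˡ-≉0 : ∀ {x y} → ¬ (x ≈ 0#) → x * y ≈ 0# → y ≈ 0#
  cancelˡ-≉0 {x} {y} x≉0 xy≈0 with noZeroDiv x y xy≈0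
  ... | inj₁ x≈0 = ⊥-elim (x≉0 x≈0)
  ... | inj₂ y≈0 = y≈0

  x²≈y²⇒x≈±y : ∀ {x y} → x * x ≈ y * y → x ≈ y ⊎ x ≈ - y
  x²≈y²⇒x≈±y {x} {y} x²≈y² with noZeroDiv (x - y) (x + y) factored
    where
    factored : (x - y) * (x + y) ≈ 0#
    factored = trans (solve 2 (λ x y → (x :- y) :* (x :+ y) := x :* x :- y :* y) refl x y) (x≈y⇒x-y≈0 x²≈y²)
  ... | inj₁ x-y≈0 = inj₁ (x-y≈0⇒x≈y _ _ x-y≈0)
  ... | inj₂ x+y≈0 = inj₂ (x-y≈0⇒x≈y _ _ (trans (+-congˡ (solve 1 (λ y → :- :- y := y) refl y)) x+y≈0))

  ι-injective : ∀ m n → ι m ≈ ι n → m ≡ n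
  ι-injective zero    zero    _ = ≡.refl
  ι-injective zero    (suc n) e = ⊥-elim (ℕ.1+n≢0 (char0 (suc n) (sym e)))
  ι-injective (suc m) zero    e = ⊥-elim (ℕ.1+n≢0 (char0 (suc m) e))
  ι-injective (suc m) (suc n) e = ≡.cong suc (ι-injective m n (begin
    ι m               ≈⟨ solve 2 (λ o x → x := (o :+ x) :- o) refl 1# (ι m) ⟩
    (1# + ι m) - 1#   ≈⟨ +-congʳ e ⟩
    (1# + ι n) - 1#   ≈⟨ solve 2 (λ o x → (o :+ x) :- o := x) refl 1# (ι n) ⟩
    ι n               ∎))

  ι-≉0 : ∀ {n} → 0 ℕ.< n → ¬ (ι n ≈ 0#)
  ι-≉0 n>0 e = ℕ.<⇒≢ n>0 (≡.sym (char0 _ e))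

  ι*-cancelʳ : ∀ {g} → g ≢ 0 → ∀ q p {X} → ι (q ℕ.* g) * X ≈ ι (p ℕ.* g) → ι q * X ≈ ι p
  ι*-cancelʳ {g} g≢0 q p {X} qgX≈pg = x-y≈0⇒x≈y _ _ (cancelˡ-≉0 (ι-≉0 (ℕ.n≢0⇒n>0 g≢0)) (begin
    ι g * (ι q * X - ι p)         ≈⟨ solve 4 (λ g q x p → g :* (q :* x :- p) := (q :* g) :* x :- p :* g) refl (ι g) (ι q) X (ι p) ⟩
    (ι q * ι g) * X - ι p * ι g   ≈⟨ +-cong (*-congʳ (ι-homo-* q g)) (-‿cong (ι-homo-* p g)) ⟨
    ι (q ℕ.* g) * X - ι (p ℕ.* g) ≈⟨ x≈y⇒x-y≈0 qgX≈pg ⟩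
    0#                            ∎))

  ι-homo-∸ : ∀ {m n} → m ≤ n → ι (n ℕ.∸ m) ≈ ι n - ι m
  ι-homo-∸ {m} {n} m≤n = begin
    ι (n ℕ.∸ m)                  ≈⟨ solve 2 (λ d x → d := (d :+ x) :- x) refl (ι (n ℕ.∸ m)) (ι m) ⟩
    (ι (n ℕ.∸ m) + ι m) - ι m    ≈⟨ +-congʳ (ι-homo-+ (n ℕ.∸ m) m) ⟨
    ι (n ℕ.∸ m ℕ.+ m) - ι m      ≡⟨ ≡.cong (λ t → ι t - ι m) (ℕ.m∸n+n≡m m≤n) ⟩
    ι n - ι m                    ∎

  1+ℓu≉0 : ∀ {ℓ} → 2 ≤ ℓ → ∀ u → ¬ (1# + ι ℓ * ιℤ u ≈ 0#)
  1+ℓu≉0 {ℓ} ℓ≥2 (ℤ.+ k) e = ℕ.1+n≢0 (char0 (suc (ℓ ℕ.* k)) (trans (+-congˡ (ι-homo-* ℓ k)) e))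
  1+ℓu≉0 {ℓ} ℓ≥2 -[1+ k ] e = ℕ.<⇒≢ (ℕ.<-≤-trans ℓ≥2 (ℕ.m≤m*n ℓ (suc k))) (ι-injective 1 (ℓ ℕ.* suc k) (begin
    ι 1                                           ≈⟨ +-identityʳ 1# ⟩
    1#                                            ≈⟨ solve 3 (λ o l s → o := (o :+ l :* (:- s)) :+ l :* s) refl 1# (ι ℓ) (ι (suc k)) ⟩
    (1# + ι ℓ * (- ι (suc k))) + ι ℓ * ι (suc k)  ≈⟨ +-congʳ e ⟩
    0# + ι ℓ * ι (suc k)                          ≈⟨ +-identityˡ _ ⟩
    ι ℓ * ι (suc k)                               ≈⟨ ι-homo-* ℓ (suc k) ⟨
    ι (ℓ ℕ.* suc k)                               ∎))

-- Finite sums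

module Sums (R : CommutativeRing 0ℓ 0ℓ) where
  open CommutativeRing R hiding (zero)
  open import Algebra.Properties.Semiring.Sum semiring public
    using (sum; sum-cong-≋; ∑-distrib-+; *-distribˡ-sum; *-distribʳ-sum; sum-replicate-zero; sum-permute)
  open import Relation.Binary.Reasoning.Setoid setoid

  sum-split-at : ∀ {n} (f g : Fin n → Carrier) (i₀ : Fin n) →
                 (∀ i → i ≢ i₀ → f i ≈ g i) → g i₀ ≈ 0# → sum f ≈ f i₀ + sum g
  sum-split-at f g zero f≈g g₀≈0 = +-congˡ (begin
    sum (f ∘ suc)            ≈⟨ sum-cong-≋ (λ i → f≈g (suc i) λ ()) ⟩
    sum (g ∘ suc)            ≈⟨ +-identityˡ _ ⟨
    0# + sum (g ∘ suc)       ≈⟨ +-congʳ g₀≈0 ⟨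
    g zero + sum (g ∘ suc)   ∎)
  sum-split-at f g (suc i₀) f≈g g₀≈0 = begin
    f zero + sum (f ∘ suc)
      ≈⟨ +-cong (f≈g zero λ ()) (sum-split-at (f ∘ suc) (g ∘ suc) i₀ (λ i i≢i₀ → f≈g (suc i) (i≢i₀ ∘ Fin.suc-injective)) g₀≈0) ⟩
    g zero + (f (suc i₀) + sum (g ∘ suc))
      ≈⟨ x∙yz≈y∙xz _ _ _ ⟩
    f (suc i₀) + (g zero + sum (g ∘ suc))
      ∎
    where open import Algebra.Properties.CommutativeSemigroup +-commutativeSemigroup using (x∙yz≈y∙xz)

  sum-supported-at : ∀ {n} (f : Fin n → Carrier) (i₀ : Fin n) → (∀ i → i ≢ i₀ → f i ≈ 0#) → sum f ≈ f i₀
  sum-supported-at {n} f i₀ f≈0 =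
    trans (sum-split-at f (λ _ → 0#) i₀ f≈0 refl) (trans (+-congˡ (sum-replicate-zero n)) (+-identityʳ _))

  ∑ₗ : {A : Set} → (A → Carrier) → List A → Carrier
  ∑ₗ f = foldr (λ x acc → f x + acc) 0#

  ∑ₗ-cong : {A : Set} {f g : A → Carrier} (xs : List A) → (∀ x → f x ≈ g x) → ∑ₗ f xs ≈ ∑ₗ g xs
  ∑ₗ-cong []       f≈g = refl
  ∑ₗ-cong (x ∷ xs) f≈g = +-cong (f≈g x) (∑ₗ-cong xs f≈g)

  ∑ₗ-++ : {A : Set} (f : A → Carrier) (xs ys : List A) → ∑ₗ f (xs ++ ys) ≈ ∑ₗ f xs + ∑ₗ f ys
  ∑ₗ-++ f []       ys = sym (+-identityˡ _)
  ∑ₗ-++ f (x ∷ xs) ys = trans (+-congˡ (∑ₗ-++ f xs ys)) (sym (+-assoc _ _ _))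

  ∑ₗ-map : {A B : Set} (f : B → Carrier) (g : A → B) (xs : List A) → ∑ₗ f (map g xs) ≡ ∑ₗ (f ∘ g) xs
  ∑ₗ-map f g []       = ≡.refl
  ∑ₗ-map f g (x ∷ xs) = ≡.cong (f (g x) +_) (∑ₗ-map f g xs)

  ∑ₗ-concatMap : {A B : Set} (f : B → Carrier) (g : A → List B) (xs : List A) →
                 ∑ₗ f (concatMap g xs) ≈ ∑ₗ (∑ₗ f ∘ g) xs
  ∑ₗ-concatMap f g []       = refl
  ∑ₗ-concatMap f g (x ∷ xs) = trans (∑ₗ-++ f (g x) (concatMap g xs)) (+-congˡ (∑ₗ-concatMap f g xs))

  *-distribˡ-∑ₗ : {A : Set} (c : Carrier) (f : A → Carrier) (xs : List A) → c * ∑ₗ f xs ≈ ∑ₗ (λ x → c * f x) xs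
  *-distribˡ-∑ₗ c f []       = zeroʳ c
  *-distribˡ-∑ₗ c f (x ∷ xs) = trans (distribˡ c _ _) (+-congˡ (*-distribˡ-∑ₗ c f xs))

  ∑ₗ-tabulate : {A : Set} (f : A → Carrier) {n : ℕ} (g : Fin n → A) → ∑ₗ f (tabulate g) ≈ sum (f ∘ g)
  ∑ₗ-tabulate f {zero}  g = refl
  ∑ₗ-tabulate f {suc n} g = +-congˡ (∑ₗ-tabulate f (g ∘ suc))

  ∑ₗ-cartesianProduct : {A B : Set} (f : A → Carrier) (g : B → Carrier) (xs : List A) (ys : List B) →
    ∑ₗ (λ p → f (proj₁ p) * g (proj₂ p)) (cartesianProduct xs ys) ≈ ∑ₗ f xs * ∑ₗ g ys
  ∑ₗ-cartesianProduct f g []       ys = sym (zeroˡ _)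
  ∑ₗ-cartesianProduct f g (x ∷ xs) ys = begin
    ∑ₗ h (map (x ,_) ys ++ cartesianProduct xs ys)          ≈⟨ ∑ₗ-++ h (map (x ,_) ys) _ ⟩
    ∑ₗ h (map (x ,_) ys) + ∑ₗ h (cartesianProduct xs ys)    ≈⟨ +-cong (reflexive (∑ₗ-map h (x ,_) ys)) (∑ₗ-cartesianProduct f g xs ys) ⟩
    ∑ₗ (λ y → f x * g y) ys + ∑ₗ f xs * ∑ₗ g ys             ≈⟨ +-congʳ (*-distribˡ-∑ₗ (f x) g ys) ⟨
    f x * ∑ₗ g ys + ∑ₗ f xs * ∑ₗ g ys                       ≈⟨ distribʳ _ _ _ ⟨
    (f x + ∑ₗ f xs) * ∑ₗ g ys                               ∎
    where h = λ p → f (proj₁ p) * g (proj₂ p)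

-- Integrality over ℤ-spans

module Integrality (R : CommutativeRing 0ℓ 0ℓ) (domain : IsChar0Domain R) where
  open CommutativeRing R hiding (zero)
  open IsChar0Domain domain
  open IntegerImage R
  open CharacteristicZeroDomain R domain
  open Sums R
  open import Relation.Binary.Reasoning.Setoid setoid

  linComb : ∀ {s} → (Fin s → ℤ) → (Fin s → Carrier) → Carrier
  linComb c V = sum (λ j → ιℤ (c j) * V j)

  _∈ℤ⟨_⟩ : ∀ {s} → Carrier → (Fin s → Carrier) → Set
  _∈ℤ⟨_⟩ {s} r V = Σ[ c ∈ (Fin s → ℤ) ] r ≈ linComb c V

  linComb-combine : ∀ {s} (V : Fin s → Carrier) α β (p q : Fin s → ℤ) →
    ιℤ α * linComb p V + ιℤ β * linComb q V ≈ linComb (λ j → α ℤ.* p j ℤ.+ β ℤ.* q j) V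
  linComb-combine V α β p q = begin
    ιℤ α * linComb p V + ιℤ β * linComb q V
      ≈⟨ +-cong (*-distribˡ-sum (ιℤ α) (λ j → ιℤ (p j) * V j)) (*-distribˡ-sum (ιℤ β) (λ j → ιℤ (q j) * V j)) ⟩
    sum (λ j → ιℤ α * (ιℤ (p j) * V j)) + sum (λ j → ιℤ β * (ιℤ (q j) * V j))
      ≈⟨ ∑-distrib-+ (λ j → ιℤ α * (ιℤ (p j) * V j)) (λ j → ιℤ β * (ιℤ (q j) * V j)) ⟨
    sum (λ j → ιℤ α * (ιℤ (p j) * V j) + ιℤ β * (ιℤ (q j) * V j))
      ≈⟨ sum-cong-≋ termwise ⟩
    linComb (λ j → α ℤ.* p j ℤ.+ β ℤ.* q j) V ∎
    where
    termwise : ∀ j → ιℤ α * (ιℤ (p j) * V j) + ιℤ β * (ιℤ (q j) * V j) ≈ ιℤ (α ℤ.* p j ℤ.+ β ℤ.* q j) * V j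
    termwise j = begin
      ιℤ α * (ιℤ (p j) * V j) + ιℤ β * (ιℤ (q j) * V j)
        ≈⟨ solve 5 (λ a b x y v → a :* (x :* v) :+ b :* (y :* v) := (a :* x :+ b :* y) :* v) refl (ιℤ α) (ιℤ β) (ιℤ (p j)) (ιℤ (q j)) (V j) ⟩
      (ιℤ α * ιℤ (p j) + ιℤ β * ιℤ (q j)) * V j
        ≈⟨ *-congʳ (+-cong (ιℤ-homo-* α (p j)) (ιℤ-homo-* β (q j))) ⟨
      (ιℤ (α ℤ.* p j) + ιℤ (β ℤ.* q j)) * V j
        ≈⟨ *-congʳ (ιℤ-homo-+ (α ℤ.* p j) (β ℤ.* q j)) ⟨
      ιℤ (α ℤ.* p j ℤ.+ β ℤ.* q j) * V j ∎

  ScaledInto : ∀ {s} → ℕ → ℤ → (Fin s → Carrier) → Set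
  ScaledInto {s} ℓ t V = ∀ i → Σ[ c ∈ (Fin s → ℤ) ] (1# + ι ℓ * ιℤ t) * V i ≈ ι ℓ * linComb c V

  -- Solving the first row for V₀ and substituting it into the others keeps the shape of the hypothesis.
  module NakayamaStep {s} (V : Fin (suc s) → Carrier) (ℓ : ℕ) (t : ℤ) (scaled : ScaledInto ℓ t V) where
    L : Carrier
    L = ι ℓ
    c₀ : Fin (suc s) → ℤ
    c₀ = proj₁ (scaled zero)
    u : ℤ
    u = t ℤ.- c₀ zero
    E₀ : Carrier
    E₀ = linComb (c₀ ∘ suc) (V ∘ suc)

    pivot : (1# + L * ιℤ u) * V zero ≈ L * E₀
    pivot = begin
      (1# + L * ιℤ u) * V zero
        ≈⟨ *-congʳ (+-congˡ (*-congˡ (trans (ιℤ-homo-+ t (ℤ.- c₀ zero)) (+-congˡ (ιℤ-homo-neg (c₀ zero)))))) ⟩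
      (1# + L * (ιℤ t - ιℤ (c₀ zero))) * V zero
        ≈⟨ solve 5 (λ o l t a v → (o :+ l :* (t :- a)) :* v := (o :+ l :* t) :* v :- l :* (a :* v)) refl 1# L (ιℤ t) (ιℤ (c₀ zero)) (V zero) ⟩
      (1# + L * ιℤ t) * V zero - L * (ιℤ (c₀ zero) * V zero)
        ≈⟨ +-congʳ (proj₂ (scaled zero)) ⟩
      L * (ιℤ (c₀ zero) * V zero + E₀) - L * (ιℤ (c₀ zero) * V zero)
        ≈⟨ solve 3 (λ l x e → l :* (x :+ e) :- l :* x := l :* e) refl L (ιℤ (c₀ zero) * V zero) E₀ ⟩
      L * E₀ ∎

    t′ : ℤ
    t′ = u ℤ.+ t ℤ.+ ℤ.+ ℓ ℤ.* u ℤ.* t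

    scaled-tail : ScaledInto ℓ t′ (V ∘ suc)
    scaled-tail i = coefficients , scaled-row
      where
      cᵢ : Fin (suc s) → ℤ
      cᵢ = proj₁ (scaled (suc i))
      C : Carrier
      C = 1# + L * ιℤ u
      cu : ℤ
      cu = ℤ.+ 1 ℤ.+ ℤ.+ ℓ ℤ.* u
      coefficients : Fin s → ℤ
      coefficients j = (ℤ.+ ℓ ℤ.* cᵢ zero) ℤ.* c₀ (suc j) ℤ.+ cu ℤ.* cᵢ (suc j)
      ιℤ-cu : ιℤ cu ≈ C
      ιℤ-cu = trans (ιℤ-homo-+ (ℤ.+ 1) (ℤ.+ ℓ ℤ.* u)) (+-cong (+-identityʳ 1#) (ιℤ-homo-* (ℤ.+ ℓ) u))
      ιℤ-t′ : 1# + L * ιℤ t′ ≈ C * (1# + L * ιℤ t)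
      ιℤ-t′ = begin
        1# + L * ιℤ t′
          ≈⟨ +-congˡ (*-congˡ (trans (ιℤ-homo-+ (u ℤ.+ t) _)
               (+-cong (ιℤ-homo-+ u t) (trans (ιℤ-homo-* (ℤ.+ ℓ ℤ.* u) t) (*-congʳ (ιℤ-homo-* (ℤ.+ ℓ) u)))))) ⟩
        1# + L * (ιℤ u + ιℤ t + L * ιℤ u * ιℤ t)
          ≈⟨ +-congʳ (+-identityʳ 1#) ⟨
        ιℤ (ℤ.+ 1) + L * (ιℤ u + ιℤ t + L * ιℤ u * ιℤ t)
          ≈⟨ solve 3 (λ l a b → con (ℤ.+ 1) :+ l :* (a :+ b :+ l :* a :* b) := (con (ℤ.+ 1) :+ l :* a) :* (con (ℤ.+ 1) :+ l :* b)) refl L (ιℤ u) (ιℤ t) ⟩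
        (ιℤ (ℤ.+ 1) + L * ιℤ u) * (ιℤ (ℤ.+ 1) + L * ιℤ t)
          ≈⟨ *-cong (+-congʳ (+-identityʳ 1#)) (+-congʳ (+-identityʳ 1#)) ⟩
        C * (1# + L * ιℤ t) ∎
      Eᵢ : Carrier
      Eᵢ = linComb (cᵢ ∘ suc) (V ∘ suc)
      scaled-row : (1# + L * ιℤ t′) * V (suc i) ≈ L * linComb coefficients (V ∘ suc)
      scaled-row = begin
        (1# + L * ιℤ t′) * V (suc i)                  ≈⟨ *-congʳ ιℤ-t′ ⟩
        (C * (1# + L * ιℤ t)) * V (suc i)             ≈⟨ *-assoc _ _ _ ⟩
        C * ((1# + L * ιℤ t) * V (suc i))             ≈⟨ *-congˡ (proj₂ (scaled (suc i))) ⟩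
        C * (L * (ιℤ (cᵢ zero) * V zero + Eᵢ))
          ≈⟨ solve 5 (λ c l b v e → c :* (l :* (b :* v :+ e)) := l :* (b :* (c :* v) :+ c :* e)) refl C L (ιℤ (cᵢ zero)) (V zero) Eᵢ ⟩
        L * (ιℤ (cᵢ zero) * (C * V zero) + C * Eᵢ)    ≈⟨ *-congˡ (+-cong (*-congˡ pivot) (*-congʳ (sym ιℤ-cu))) ⟩
        L * (ιℤ (cᵢ zero) * (L * E₀) + ιℤ cu * Eᵢ)
          ≈⟨ *-congˡ (+-congʳ (trans (solve 3 (λ b l e → b :* (l :* e) := (l :* b) :* e) refl (ιℤ (cᵢ zero)) L E₀) (*-congʳ (sym (ιℤ-homo-* (ℤ.+ ℓ) (cᵢ zero)))))) ⟩
        L * (ιℤ (ℤ.+ ℓ ℤ.* cᵢ zero) * E₀ + ιℤ cu * Eᵢ) ≈⟨ *-congˡ (linComb-combine (V ∘ suc) (ℤ.+ ℓ ℤ.* cᵢ zero) cu (c₀ ∘ suc) (cᵢ ∘ suc)) ⟩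
        L * linComb coefficients (V ∘ suc)            ∎

  nakayama : ∀ {s} (V : Fin s → Carrier) {ℓ} → 2 ≤ ℓ → ∀ t → ScaledInto ℓ t V → ∀ i → V i ≈ 0#
  nakayama {zero}  V ℓ≥2 t scaled ()
  nakayama {suc s} V {ℓ} ℓ≥2 t scaled = λ where
      zero    → V₀≈0
      (suc i) → tail≈0 i
    where
    open NakayamaStep V ℓ t scaled
    tail≈0 : ∀ i → V (suc i) ≈ 0#
    tail≈0 = nakayama (V ∘ suc) ℓ≥2 t′ scaled-tail
    V₀≈0 : V zero ≈ 0#
    V₀≈0 = cancelˡ-≉0 (1+ℓu≉0 ℓ≥2 u) (begin
      (1# + L * ιℤ u) * V zero  ≈⟨ pivot ⟩
      L * E₀                    ≈⟨ *-congˡ (sum-cong-≋ {n = s} (λ j → trans (*-congˡ (tail≈0 j)) (zeroʳ _))) ⟩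
      L * sum {s} (λ _ → 0#)    ≈⟨ *-congˡ (sum-replicate-zero s) ⟩
      L * 0#                    ≈⟨ zeroʳ L ⟩
      0#                        ∎)

  module Span {s} (V : Fin s → Carrier) where

    ∈-resp-≈ : ∀ {r r′} → r ∈ℤ⟨ V ⟩ → r ≈ r′ → r′ ∈ℤ⟨ V ⟩
    ∈-resp-≈ (c , r≈) r≈r′ = c , trans (sym r≈r′) r≈

    ∈-combine : ∀ {r r′} → r ∈ℤ⟨ V ⟩ → r′ ∈ℤ⟨ V ⟩ → ∀ α β → (ιℤ α * r + ιℤ β * r′) ∈ℤ⟨ V ⟩
    ∈-combine (c , r≈) (c′ , r′≈) α β =
      (λ j → α ℤ.* c j ℤ.+ β ℤ.* c′ j) , trans (+-cong (*-congˡ r≈) (*-congˡ r′≈)) (linComb-combine V α β c c′)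

    0∈ : 0# ∈ℤ⟨ V ⟩
    0∈ = (λ _ → ℤ.0ℤ) , sym (trans (sum-cong-≋ (λ j → zeroˡ (V j))) (sum-replicate-zero s))

    +-∈ : ∀ {r r′} → r ∈ℤ⟨ V ⟩ → r′ ∈ℤ⟨ V ⟩ → (r + r′) ∈ℤ⟨ V ⟩
    +-∈ r∈ r′∈ = ∈-resp-≈ (∈-combine r∈ r′∈ (ℤ.+ 1) (ℤ.+ 1)) (+-cong (1·x≈x _) (1·x≈x _))
      where
      1·x≈x : ∀ x → ιℤ (ℤ.+ 1) * x ≈ x
      1·x≈x x = trans (*-congʳ (+-identityʳ 1#)) (*-identityˡ x)

    ιℤ*-∈ : ∀ {r} α → r ∈ℤ⟨ V ⟩ → (ιℤ α * r) ∈ℤ⟨ V ⟩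
    ιℤ*-∈ α r∈ = ∈-resp-≈ (∈-combine r∈ 0∈ α ℤ.0ℤ) (trans (+-congˡ (zeroˡ _)) (+-identityʳ _))

    V∈ : ∀ k → V k ∈ℤ⟨ V ⟩
    V∈ k = indicator , sym (trans (sum-supported-at _ k off-k) at-k)
      where
      indicator : Fin s → ℤ
      indicator j with j Fin.≟ k
      ... | yes _ = ℤ.+ 1
      ... | no _  = ℤ.0ℤ
      off-k : ∀ j → j ≢ k → ιℤ (indicator j) * V j ≈ 0#
      off-k j j≢k with j Fin.≟ k
      ... | yes j≡k = ⊥-elim (j≢k j≡k)
      ... | no _    = zeroˡ _
      at-k : ιℤ (indicator k) * V k ≈ V k
      at-k with k Fin.≟ k
      ... | yes _   = trans (*-congʳ (+-identityʳ 1#)) (*-identityˡ _)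
      ... | no k≢k  = ⊥-elim (k≢k ≡.refl)

    sum-∈ : ∀ {n} (f : Fin n → Carrier) → (∀ i → f i ∈ℤ⟨ V ⟩) → sum f ∈ℤ⟨ V ⟩
    sum-∈ {zero}  f f∈ = 0∈
    sum-∈ {suc n} f f∈ = +-∈ (f∈ zero) (sum-∈ (f ∘ suc) (f∈ ∘ suc))

    module Subring (V*V∈ : ∀ i j → (V i * V j) ∈ℤ⟨ V ⟩) (i₁ : Fin s) (V₁≈1 : V i₁ ≈ 1#) where

      V*-∈ : ∀ i {r} → r ∈ℤ⟨ V ⟩ → (V i * r) ∈ℤ⟨ V ⟩
      V*-∈ i {r} (d , r≈) = ∈-resp-≈ (sum-∈ _ (λ j → ιℤ*-∈ (d j) (V*V∈ i j))) (sym (begin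
        V i * r                                ≈⟨ *-congˡ r≈ ⟩
        V i * linComb d V                      ≈⟨ *-distribˡ-sum (V i) (λ j → ιℤ (d j) * V j) ⟩
        sum (λ j → V i * (ιℤ (d j) * V j))     ≈⟨ sum-cong-≋ (λ j → x∙yz≈y∙xz (V i) (ιℤ (d j)) (V j)) ⟩
        sum (λ j → ιℤ (d j) * (V i * V j))     ∎))
        where open import Algebra.Properties.CommutativeSemigroup *-commutativeSemigroup using (x∙yz≈y∙xz)

      *-∈ : ∀ {r r′} → r ∈ℤ⟨ V ⟩ → r′ ∈ℤ⟨ V ⟩ → (r * r′) ∈ℤ⟨ V ⟩
      *-∈ {r} {r′} (c , r≈) r′∈ = ∈-resp-≈ (sum-∈ _ (λ i → ιℤ*-∈ (c i) (V*-∈ i r′∈))) (sym (begin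
        r * r′                                 ≈⟨ *-congʳ r≈ ⟩
        linComb c V * r′                       ≈⟨ *-distribʳ-sum r′ (λ i → ιℤ (c i) * V i) ⟩
        sum (λ i → ιℤ (c i) * V i * r′)        ≈⟨ sum-cong-≋ (λ i → *-assoc (ιℤ (c i)) (V i) r′) ⟩
        sum (λ i → ιℤ (c i) * (V i * r′))      ∎))

      1∈ : 1# ∈ℤ⟨ V ⟩
      1∈ = ∈-resp-≈ (V∈ i₁) V₁≈1

      1/ℓ∉ : ∀ {ℓ} → 2 ≤ ℓ → ∀ {z} → z ∈ℤ⟨ V ⟩ → 1# ≈ ι ℓ * z → ⊥
      1/ℓ∉ {ℓ} ℓ≥2 {z} z∈ 1≈ℓz = nontrivial (trans (sym V₁≈1) (nakayama V ℓ≥2 ℤ.0ℤ scaled i₁))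
        where
        scaled : ScaledInto ℓ ℤ.0ℤ V
        scaled i = proj₁ zVᵢ∈ , (begin
          (1# + ι ℓ * 0#) * V i   ≈⟨ *-congʳ (trans (+-congˡ (zeroʳ _)) (+-identityʳ 1#)) ⟩
          1# * V i                ≈⟨ *-congʳ 1≈ℓz ⟩
          (ι ℓ * z) * V i         ≈⟨ *-assoc _ _ _ ⟩
          ι ℓ * (z * V i)         ≈⟨ *-congˡ (proj₂ zVᵢ∈) ⟩
          ι ℓ * linComb (proj₁ zVᵢ∈) V ∎)
          where
          zVᵢ∈ : (z * V i) ∈ℤ⟨ V ⟩
          zVᵢ∈ = *-∈ z∈ (V∈ i)

      1/q∈ : ∀ {X q p} → X ∈ℤ⟨ V ⟩ → ι q * X ≈ ι p → Coprime q p →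
                     Σ[ z ∈ Carrier ] z ∈ℤ⟨ V ⟩ × 1# ≈ ι q * z
      1/q∈ {X} {q} {p} X∈ qX≈p q⊥p with coprime-Bézout q⊥p
      ... | Bézout.+- x y 1+yp≡xq = _ , ∈-combine 1∈ X∈ (ℤ.+ x) (ℤ.- ℤ.+ y) , sym (begin
        ι q * (ι x * 1# + ιℤ (ℤ.- ℤ.+ y) * X)  ≈⟨ *-congˡ (+-cong (*-identityʳ _) (*-congʳ (ιℤ-homo-neg (ℤ.+ y)))) ⟩
        ι q * (ι x + (- ι y) * X)
          ≈⟨ solve 4 (λ q x y X → q :* (x :+ (:- y) :* X) := x :* q :- y :* (q :* X)) refl (ι q) (ι x) (ι y) X ⟩
        ι x * ι q - ι y * (ι q * X)            ≈⟨ +-cong (sym (ι-homo-* x q)) (-‿cong (*-congˡ qX≈p)) ⟩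
        ι (x ℕ.* q) - ι y * ι p                ≈⟨ +-congʳ (reflexive (≡.cong ι (≡.sym 1+yp≡xq))) ⟩
        ι (1 ℕ.+ y ℕ.* p) - ι y * ι p          ≈⟨ +-congʳ (trans (ι-homo-+ 1 (y ℕ.* p)) (+-cong (+-identityʳ 1#) (ι-homo-* y p))) ⟩
        (1# + ι y * ι p) - ι y * ι p           ≈⟨ solve 2 (λ o a → (o :+ a) :- a := o) refl 1# (ι y * ι p) ⟩
        1#                                     ∎)
      ... | Bézout.-+ x y 1+xq≡yp = _ , ∈-combine X∈ 1∈ (ℤ.+ y) (ℤ.- ℤ.+ x) , sym (begin
        ι q * (ι y * X + ιℤ (ℤ.- ℤ.+ x) * 1#)  ≈⟨ *-congˡ (+-congˡ (trans (*-identityʳ _) (ιℤ-homo-neg (ℤ.+ x)))) ⟩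
        ι q * (ι y * X - ι x)
          ≈⟨ solve 4 (λ q x y X → q :* (y :* X :- x) := y :* (q :* X) :- x :* q) refl (ι q) (ι x) (ι y) X ⟩
        ι y * (ι q * X) - ι x * ι q            ≈⟨ +-cong (*-congˡ qX≈p) (-‿cong (sym (ι-homo-* x q))) ⟩
        ι y * ι p - ι (x ℕ.* q)                ≈⟨ +-cong (sym (ι-homo-* y p)) refl ⟩
        ι (y ℕ.* p) - ι (x ℕ.* q)              ≈⟨ +-congʳ (reflexive (≡.cong ι (≡.sym 1+xq≡yp))) ⟩
        ι (1 ℕ.+ x ℕ.* q) - ι (x ℕ.* q)        ≈⟨ +-congʳ (ι-homo-+ 1 (x ℕ.* q)) ⟩
        (ι 1 + ι (x ℕ.* q)) - ι (x ℕ.* q)      ≈⟨ solve 2 (λ o a → (o :+ a) :- a := o) refl (ι 1) (ι (x ℕ.* q)) ⟩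
        ι 1                                    ≈⟨ +-identityʳ 1# ⟩
        1#                                     ∎)

      integral : ∀ {X q p} → X ∈ℤ⟨ V ⟩ → 0 ℕ.< q → ι q * X ≈ ι p → q ∣ p
      integral {X} {q} {p} X∈ q>0 qX≈p = from-reduced (q′ ℕ.≟ 1)
        where
        g : ℕ
        g = gcd q p
        g≢0 : g ≢ 0
        g≢0 g≡0 = ℕ.<⇒≢ q>0 (≡.sym (gcd[m,n]≡0⇒m≡0 g≡0))
        instance
          _ : ℕ.NonZero g
          _ = ℕ.≢-nonZero g≢0
        q′ p′ : ℕ
        q′ = q / g
        p′ = p / g
        q′g≡q : q′ ℕ.* g ≡ q
        q′g≡q = m/n*n≡m (gcd[m,n]∣m q p)
        p′g≡p : p′ ℕ.* g ≡ p
        p′g≡p = m/n*n≡m (gcd[m,n]∣n q p)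
        q′X≈p′ : ι q′ * X ≈ ι p′
        q′X≈p′ = ι*-cancelʳ g≢0 q′ p′ (≡.subst₂ (λ s t → ι s * X ≈ ι t) (≡.sym q′g≡q) (≡.sym p′g≡p) qX≈p)
        from-reduced : Dec (q′ ≡ 1) → q ∣ p
        from-reduced (yes q′≡1) = ≡.subst (_∣ p) g≡q (gcd[m,n]∣n q p)
          where
          g≡q : g ≡ q
          g≡q = ≡.trans (≡.sym (ℕ.*-identityˡ g)) (≡.trans (≡.cong (ℕ._* g) (≡.sym q′≡1)) q′g≡q)
        from-reduced (no q′≢1) = ⊥-elim (1/ℓ∉ q′≥2 (proj₁ (proj₂ 1/q′)) (proj₂ (proj₂ 1/q′)))
          where
          1/q′ : Σ[ z ∈ Carrier ] z ∈ℤ⟨ V ⟩ × 1# ≈ ι q′ * z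
          1/q′ = 1/q∈ X∈ q′X≈p′ (coprime-/gcd q p)
          q′≢0 : q′ ≢ 0
          q′≢0 q′≡0 = ℕ.<⇒≢ q>0 (≡.trans (≡.sym (≡.cong (ℕ._* g) q′≡0)) q′g≡q)
          q′≥2 : 2 ≤ q′
          q′≥2 = ℕ.≤∧≢⇒< (ℕ.n≢0⇒n>0 q′≢0) (q′≢1 ∘ ≡.sym)

-- Character sums of an SEDF

module Characters (G : FinAbGroup) (R : CommutativeRing 0ℓ 0ℓ) (domain : IsChar0Domain R) where
  open FinAbGroup G renaming (Carrier to Gₑ)
  open CommutativeRing R hiding (zero)
  open IntegerImage R
  open CharacteristicZeroDomain R domain
  open Sums R
  open Integrality R domain
  open import Relation.Binary.Reasoning.Setoid setoid

  private
    abelianGroup : AbelianGroup 0ℓ 0ℓ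
    abelianGroup = record { isAbelianGroup = isAbelianGroup }
  open import Algebra.Properties.AbelianGroup abelianGroup using (⁻¹-∙-comm)
  open import Algebra.Properties.Group (AbelianGroup.group abelianGroup)
    using (⁻¹-involutive; ε⁻¹≈ε; \\-leftDividesˡ; \\-leftDividesʳ)

  element : Fin order → Gₑ
  element = Inverse.to enum

  index : Gₑ → Fin order
  index = Inverse.from enum

  element-index : ∀ g → element (index g) ≡ g
  element-index = Inverse.strictlyInverseˡ enum

  index-element : ∀ i → index (element i) ≡ i
  index-element = Inverse.strictlyInverseʳ enum

  module _ {χ : Gₑ → Carrier} (isχ : IsCharacter G R χ) where
    open IsCharacter isχ

    χ-inverse : IsCharacter G R (χ ∘ _⁻¹)
    χ-inverse = record
      { χ-ε = trans (reflexive (≡.cong χ ε⁻¹≈ε)) χ-ε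
      ; χ-∙ = λ g h → trans (reflexive (≡.cong χ (≡.sym (⁻¹-∙-comm g h)))) (χ-∙ (g ⁻¹) (h ⁻¹))
      }

    χ-inverse-nonprincipal : Nonprincipal G R χ → Nonprincipal G R (χ ∘ _⁻¹)
    χ-inverse-nonprincipal (h , χh≉1) = h ⁻¹ , λ χh⁻¹⁻¹≈1 → χh≉1 (trans (reflexive (≡.cong χ (≡.sym (⁻¹-involutive h)))) χh⁻¹⁻¹≈1)

    values : Fin order → Carrier
    values = χ ∘ element

    values-ε : values (index ε) ≈ 1#
    values-ε = trans (reflexive (≡.cong χ (element-index ε))) χ-ε

    ∑-nonprincipal≈0 : Nonprincipal G R χ → sum values ≈ 0#
    ∑-nonprincipal≈0 (h , χh≉1) = cancelˡ-≉0 (λ 1-χh≈0 → χh≉1 (sym (x-y≈0⇒x≈y _ _ 1-χh≈0))) (begin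
      (1# - χ h) * sum values                ≈⟨ solve 3 (λ o a s → (o :- a) :* s := o :* s :- a :* s) refl 1# (χ h) (sum values) ⟩
      1# * sum values - χ h * sum values     ≈⟨ +-congʳ (*-identityˡ _) ⟩
      sum values - χ h * sum values          ≈⟨ x≈y⇒x-y≈0 translated ⟩
      0#                                     ∎)
      where
      translation : Fin order ↔ Fin order
      translation = mk↔ₛ′ (λ i → index (h ∙ element i)) (λ i → index ((h ⁻¹) ∙ element i))
        (λ i → ≡.trans (≡.cong (λ g → index (h ∙ g)) (element-index _)) (≡.trans (≡.cong index (\\-leftDividesˡ h (element i))) (index-element i)))
        (λ i → ≡.trans (≡.cong (λ g → index ((h ⁻¹) ∙ g)) (element-index _)) (≡.trans (≡.cong index (\\-leftDividesʳ h (element i))) (index-element i)))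
      translated : sum values ≈ χ h * sum values
      translated = begin
        sum values                                ≈⟨ sum-permute values translation ⟩
        sum (λ i → values (index (h ∙ element i))) ≈⟨ sum-cong-≋ (λ i → trans (reflexive (≡.cong χ (element-index _))) (χ-∙ h (element i))) ⟩
        sum (λ i → χ h * values i)                ≈⟨ *-distribˡ-sum (χ h) values ⟨
        χ h * sum values                          ∎

    multiplicity : {A : Set} → (A → Gₑ) → List A → Gₑ → ℕ
    multiplicity f ps g = length (filter (λ p → f p ≟ g) ps)

    χ≈∑-point : ∀ g → χ g ≈ sum (λ i → if ⌊ g ≟ element i ⌋ then values i else 0#)
    χ≈∑-point g = sym (trans (sum-supported-at _ (index g) off-g) at-g)
      where
      off-g : ∀ i → i ≢ index g → (if ⌊ g ≟ element i ⌋ then values i else 0#) ≈ 0#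
      off-g i i≢ with g ≟ element i
      ... | yes g≡ = ⊥-elim (i≢ (≡.trans (≡.sym (index-element i)) (≡.cong index (≡.sym g≡))))
      ... | no _   = refl
      at-g : (if ⌊ g ≟ element (index g) ⌋ then values (index g) else 0#) ≈ χ g
      at-g with g ≟ element (index g)
      ... | yes g≡ = reflexive (≡.cong χ (≡.sym g≡))
      ... | no g≢  = ⊥-elim (g≢ (≡.sym (element-index g)))

    ∑ₗ-χ≈∑-multiplicity : {A : Set} (f : A → Gₑ) (ps : List A) →
      ∑ₗ (χ ∘ f) ps ≈ sum (λ i → ι (multiplicity f ps (element i)) * values i)
    ∑ₗ-χ≈∑-multiplicity f []       = sym (trans (sum-cong-≋ (λ i → zeroˡ (values i))) (sum-replicate-zero order))
    ∑ₗ-χ≈∑-multiplicity f (p ∷ ps) = begin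
      χ (f p) + ∑ₗ (χ ∘ f) ps
        ≈⟨ +-cong (χ≈∑-point (f p)) (∑ₗ-χ≈∑-multiplicity f ps) ⟩
      sum (λ i → if ⌊ f p ≟ element i ⌋ then values i else 0#) + sum (λ i → ι (multiplicity f ps (element i)) * values i)
        ≈⟨ ∑-distrib-+ (λ i → if ⌊ f p ≟ element i ⌋ then values i else 0#) _ ⟨
      sum (λ i → (if ⌊ f p ≟ element i ⌋ then values i else 0#) + ι (multiplicity f ps (element i)) * values i)
        ≈⟨ sum-cong-≋ count-p ⟩
      sum (λ i → ι (multiplicity f (p ∷ ps) (element i)) * values i) ∎
      where
      count-p : ∀ i → (if ⌊ f p ≟ element i ⌋ then values i else 0#) + ι (multiplicity f ps (element i)) * values i
                      ≈ ι (multiplicity f (p ∷ ps) (element i)) * values i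
      count-p i with f p ≟ element i
      ... | yes _ = trans (+-congʳ (sym (*-identityˡ (values i)))) (sym (distribʳ (values i) 1# _))
      ... | no _  = +-identityˡ _

    open Span values

    χ∈ : ∀ g → χ g ∈ℤ⟨ values ⟩
    χ∈ g = ∈-resp-≈ (V∈ (index g)) (reflexive (≡.cong χ (element-index g)))

    values*values∈ : ∀ i j → (values i * values j) ∈ℤ⟨ values ⟩
    values*values∈ i j = ∈-resp-≈ (χ∈ (element i ∙ element j)) (χ-∙ (element i) (element j))

    ∑ₗ-∈ : (f : Gₑ → Carrier) → (∀ g → f g ∈ℤ⟨ values ⟩) → ∀ gs → ∑ₗ f gs ∈ℤ⟨ values ⟩
    ∑ₗ-∈ f f∈ []       = 0∈
    ∑ₗ-∈ f f∈ (g ∷ gs) = +-∈ (f∈ g) (∑ₗ-∈ f f∈ gs)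

    open Subring values*values∈ (index ε) values-ε

    ∑ₗ*∑ₗ-integral : ∀ gs hs {q p} → 0 ℕ.< q → ι q * (∑ₗ χ gs * ∑ₗ (χ ∘ _⁻¹) hs) ≈ ι p → q ∣ p
    ∑ₗ*∑ₗ-integral gs hs = integral (*-∈ (∑ₗ-∈ χ χ∈ gs) (∑ₗ-∈ (χ ∘ _⁻¹) (χ∈ ∘ _⁻¹) hs))

    difference : Gₑ × Gₑ → Gₑ
    difference p = proj₁ p ∙ (proj₂ p ⁻¹)

    module Pairing (nonprincipal : Nonprincipal G R χ) {m k lam : ℕ} {D : Fin m → List Gₑ} (sedf : IsSEDF G m k lam D) where

      ∑-λ[G-1] : sum (λ i → ι (if ⌊ element i ≟ ε ⌋ then 0 else lam) * values i) ≈ - ι lam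
      ∑-λ[G-1] = begin
        W                               ≈⟨ solve 2 (λ l w → w := (l :+ w) :- l) refl (ι lam) W ⟩
        (ι lam + W) - ι lam             ≈⟨ +-congʳ (+-congʳ (trans (*-congˡ values-ε) (*-identityʳ _))) ⟨
        (ι lam * values (index ε) + W) - ι lam ≈⟨ +-congʳ (sum-split-at (λ i → ι lam * values i) w (index ε) off-ε at-ε) ⟨
        sum (λ i → ι lam * values i) - ι lam ≈⟨ +-congʳ (*-distribˡ-sum (ι lam) values) ⟨
        ι lam * sum values - ι lam      ≈⟨ +-congʳ (trans (*-congˡ (∑-nonprincipal≈0 nonprincipal)) (zeroʳ _)) ⟩
        0# - ι lam                      ≈⟨ +-identityˡ _ ⟩
        - ι lam                         ∎
        where
        w : Fin order → Carrier
        w i = ι (if ⌊ element i ≟ ε ⌋ then 0 else lam) * values i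
        W : Carrier
        W = sum w
        off-ε : ∀ i → i ≢ index ε → ι lam * values i ≈ w i
        off-ε i i≢ with element i ≟ ε
        ... | yes i≡ = ⊥-elim (i≢ (≡.trans (≡.sym (index-element i)) (≡.cong index i≡)))
        ... | no _   = refl
        at-ε : w (index ε) ≈ 0#
        at-ε with element (index ε) ≟ ε
        ... | yes _ = zeroˡ _
        ... | no ≢ε = ⊥-elim (≢ε (element-index ε))

      x y : Fin m → Carrier
      x j = ∑ₗ χ (D j)
      y j = ∑ₗ (χ ∘ _⁻¹) (D j)

      ∑ₗ-crossPairs : ∀ j → ∑ₗ (χ ∘ difference) (crossPairs G m D j) ≈ x j * sum y - x j * y j
      ∑ₗ-crossPairs j = begin
        ∑ₗ F (crossPairs G m D j)               ≈⟨ ∑ₗ-concatMap F block (allFin m) ⟩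
        ∑ₗ (∑ₗ F ∘ block) (allFin m)            ≈⟨ ∑ₗ-tabulate (∑ₗ F ∘ block) (λ i → i) ⟩
        sum (∑ₗ F ∘ block)                      ≈⟨ sum-cong-≋ block-sum ⟩
        sum B                                   ≈⟨ solve 2 (λ a s → s := (a :+ s) :- a) refl (x j * y j) (sum B) ⟩
        (x j * y j + sum B) - x j * y j          ≈⟨ +-congʳ (sum-split-at (λ i → x j * y i) B j off-j at-j) ⟨
        sum (λ i → x j * y i) - x j * y j        ≈⟨ +-congʳ (*-distribˡ-sum (x j) y) ⟨
        x j * sum y - x j * y j                  ∎
        where
        F : Gₑ × Gₑ → Carrier
        F = χ ∘ difference
        block : Fin m → List (Gₑ × Gₑ)
        block i = if ⌊ i Fin.≟ j ⌋ then [] else cartesianProduct (D j) (D i)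
        B : Fin m → Carrier
        B i = if ⌊ i Fin.≟ j ⌋ then 0# else x j * y i
        block-sum : ∀ i → ∑ₗ F (block i) ≈ B i
        block-sum i with i Fin.≟ j
        ... | yes _ = refl
        ... | no _  = trans (∑ₗ-cong (cartesianProduct (D j) (D i)) (λ p → χ-∙ (proj₁ p) (proj₂ p ⁻¹)))
                            (∑ₗ-cartesianProduct χ (χ ∘ _⁻¹) (D j) (D i))
        off-j : ∀ i → i ≢ j → x j * y i ≈ B i
        off-j i i≢j with i Fin.≟ j
        ... | yes i≡j = ⊥-elim (i≢j i≡j)
        ... | no _    = refl
        at-j : B j ≈ 0#
        at-j with j Fin.≟ j
        ... | yes _  = refl
        ... | no j≢j = ⊥-elim (j≢j ≡.refl)

      sedf-character-equation : ∀ j → x j * sum y - x j * y j ≈ - ι lam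
      sedf-character-equation j = begin
        x j * sum y - x j * y j                                  ≈⟨ ∑ₗ-crossPairs j ⟨
        ∑ₗ (χ ∘ difference) (crossPairs G m D j) ≈⟨ ∑ₗ-χ≈∑-multiplicity difference (crossPairs G m D j) ⟩
        sum (λ i → ι (coeff G m D j (element i)) * values i)      ≈⟨ sum-cong-≋ (λ i → reflexive (≡.cong (λ n → ι n * values i) (IsSEDF.equation sedf j (element i)))) ⟩
        sum (λ i → ι (if ⌊ element i ≟ ε ⌋ then 0 else lam) * values i) ≈⟨ ∑-λ[G-1] ⟩
        - ι lam                                                  ∎

  module SEDFCharacterSums {χ : Gₑ → Carrier} (isχ : IsCharacter G R χ) (nonprincipal : Nonprincipal G R χ)
                           {m k lam : ℕ} {D : Fin m → List Gₑ} (sedf : IsSEDF G m k lam D) where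
    open IsCharacter isχ
    open module Direct = Pairing isχ nonprincipal sedf using (x; y) public
    module Inverted = Pairing (χ-inverse isχ) (χ-inverse-nonprincipal isχ nonprincipal) sedf

    y⁻¹≈x : ∀ j → Inverted.y j ≈ x j
    y⁻¹≈x j = ∑ₗ-cong (D j) (λ g → reflexive (≡.cong χ (⁻¹-involutive g)))

    x-equation : ∀ j → x j * sum y - x j * y j ≈ - ι lam
    x-equation = Direct.sedf-character-equation

    y-equation : ∀ j → y j * sum x - y j * x j ≈ - ι lam
    y-equation j = trans (sym (+-cong (*-congˡ (sum-cong-≋ y⁻¹≈x)) (-‿cong (*-congˡ (y⁻¹≈x j))))) (Inverted.sedf-character-equation j)

    χsum≈∑x : χsum G R χ (union G m D) ≈ sum x
    χsum≈∑x = trans (∑ₗ-concatMap χ D (allFin m)) (∑ₗ-tabulate x (λ i → i))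

    χsumInv≈∑y : χsumInv G R χ (union G m D) ≈ sum y
    χsumInv≈∑y = trans (reflexive (∑ₗ-map χ _⁻¹ (union G m D))) (trans (∑ₗ-concatMap (χ ∘ _⁻¹) D (allFin m)) (∑ₗ-tabulate y (λ i → i)))

    ∑x≉0 : ¬ (χsum G R χ (union G m D) ≈ 0#) → ¬ (sum x ≈ 0#)
    ∑x≉0 χ[D]≉0 ∑x≈0 = χ[D]≉0 (trans χsum≈∑x ∑x≈0)

    normSq→∑x*∑y : ∀ {c d e} → c * normSq G R χ (union G m D) ≈ d * (normSq G R χ (union G m D) + e) →
                   c * (sum x * sum y) ≈ d * (sum x * sum y + e)
    normSq→∑x*∑y c*N≈d*[N+e] = trans (*-congˡ (sym normSq≈)) (trans c*N≈d*[N+e] (*-congˡ (+-congʳ normSq≈)))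
      where
      normSq≈ : normSq G R χ (union G m D) ≈ sum x * sum y
      normSq≈ = *-cong χsum≈∑x χsumInv≈∑y

    x*y-integral : ∀ j {q p} → 0 ℕ.< q → ι q * (x j * y j) ≈ ι p → q ∣ p
    x*y-integral j = ∑ₗ*∑ₗ-integral isχ (D j) (D j)

-- The signs of a (2 x_j - S)

count : ∀ {m} → (Fin m → Bool) → ℕ
count {zero}  f = 0
count {suc m} f = (if f zero then 1 else 0) ℕ.+ count (f ∘ suc)

count+count-not≡size : ∀ {m} (f : Fin m → Bool) → count f ℕ.+ count (not ∘ f) ≡ m
count+count-not≡size {zero}  f = ≡.refl
count+count-not≡size {suc m} f with f zero
... | true  = ≡.cong suc (count+count-not≡size (f ∘ suc))
... | false = ≡.trans (ℕ.+-suc (count (f ∘ suc)) _) (≡.cong suc (count+count-not≡size (f ∘ suc)))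

count>0⇒witness : ∀ {m} (f : Fin m → Bool) → 0 ℕ.< count f → Σ[ j ∈ Fin m ] f j ≡ true
count>0⇒witness {suc m} f count>0 with f zero in f₀≡
... | true  = zero , f₀≡
... | false with count>0⇒witness (f ∘ suc) count>0
...   | j , fj≡ = suc j , fj≡

module SignChoice (R : CommutativeRing 0ℓ 0ℓ) (domain : IsChar0Domain R) where
  open CommutativeRing R hiding (zero)
  open IsChar0Domain domain
  open IntegerImage R
  open CharacteristicZeroDomain R domain
  open Sums R
  open import Relation.Binary.Reasoning.Setoid setoid

  ∑-signed : ∀ {m} (σ : Fin m → Bool) z → sum (λ j → if σ j then z else - z) ≈ ι (count σ) * z - ι (count (not ∘ σ)) * z
  ∑-signed {zero}  σ z = solve 1 (λ z → con ℤ.0ℤ := con ℤ.0ℤ :* z :- con ℤ.0ℤ :* z) refl z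
  ∑-signed {suc m} σ z with σ zero
  ... | true  = trans (+-cong (sym (*-identityˡ z)) (∑-signed (σ ∘ suc) z))
      (solve 4 (λ o z p q → o :* z :+ (p :* z :- q :* z) := (o :+ p) :* z :- q :* z) refl 1# z (ι (count (σ ∘ suc))) (ι (count (not ∘ σ ∘ suc))))
  ... | false = trans (+-cong (-‿cong (sym (*-identityˡ z))) (∑-signed (σ ∘ suc) z))
      (solve 4 (λ o z p q → (:- (o :* z)) :+ (p :* z :- q :* z) := p :* z :- (o :+ q) :* z) refl 1# z (ι (count (σ ∘ suc))) (ι (count (not ∘ σ ∘ suc))))

  ∑-constant : ∀ n c → sum {n} (λ _ → c) ≈ ι n * c
  ∑-constant zero    c = sym (zeroˡ c)
  ∑-constant (suc n) c = trans (+-cong (sym (*-identityˡ c)) (∑-constant n c)) (sym (distribʳ c 1# (ι n)))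

  module Signs {m} (lam a b : ℕ) (x y : Fin m → Carrier)
           (x-equation : ∀ j → x j * sum y - x j * y j ≈ - ι lam)
           (y-equation : ∀ j → y j * sum x - y j * x j ≈ - ι lam)
           (ratio : ι (b ℕ.* b) * (sum x * sum y) ≈ ι (a ℕ.* a) * (sum x * sum y + ι (4 ℕ.* lam)))
           (S≉0 : ¬ (sum x ≈ 0#)) (a>0 : 0 ℕ.< a) (lam>0 : 0 ℕ.< lam) where
    S T N L â b̂ : Carrier
    S = sum x
    T = sum y
    N = S * T
    L = ι lam
    â = ι a
    b̂ = ι b

    x-relation : ∀ j → x j * T - x j * y j + L ≈ 0#
    x-relation j = trans (+-congʳ (x-equation j)) (-‿inverseˡ L)

    y-relation : ∀ j → y j * S - x j * y j + L ≈ 0#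
    y-relation j = trans (+-congʳ (trans (+-congˡ (-‿cong (*-comm (x j) (y j)))) (y-equation j))) (-‿inverseˡ L)

    ratio-relation : b̂ * b̂ * N - â * â * (N + ιℤ (ℤ.+ 4) * L) ≈ 0#
    ratio-relation = x≈y⇒x-y≈0 (begin
      b̂ * b̂ * N                 ≈⟨ *-congʳ (ι-homo-* b b) ⟨
      ι (b ℕ.* b) * N           ≈⟨ ratio ⟩
      ι (a ℕ.* a) * (N + ι (4 ℕ.* lam)) ≈⟨ *-cong (ι-homo-* a a) (+-congˡ (ι-homo-* 4 lam)) ⟩
      â * â * (N + ιℤ (ℤ.+ 4) * L) ∎)

    N≉0 : ¬ (N ≈ 0#)
    N≉0 N≈0 = ι-≉0 (ℕ.*-mono-< (ℕ.*-mono-< a>0 a>0) (ℕ.*-mono-< (ℕ.z<s {3}) lam>0)) (begin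
      ι (a ℕ.* a ℕ.* (4 ℕ.* lam))         ≈⟨ ι-homo-* (a ℕ.* a) _ ⟩
      ι (a ℕ.* a) * ι (4 ℕ.* lam)         ≈⟨ *-congˡ (+-identityˡ _) ⟨
      ι (a ℕ.* a) * (0# + ι (4 ℕ.* lam))  ≈⟨ *-congˡ (+-congʳ N≈0) ⟨
      ι (a ℕ.* a) * (N + ι (4 ℕ.* lam))   ≈⟨ ratio ⟨
      ι (b ℕ.* b) * N                     ≈⟨ *-congˡ N≈0 ⟩
      ι (b ℕ.* b) * 0#                    ≈⟨ zeroʳ _ ⟩
      0#                                  ∎)

    zero-combination : ∀ p q r → p * 0# + q * 0# + r * 0# ≈ 0#
    zero-combination = solve 3 (λ p q r → p :* con ℤ.0ℤ :+ q :* con ℤ.0ℤ :+ r :* con ℤ.0ℤ := con ℤ.0ℤ) refl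

    u : Fin m → Carrier
    u j = ιℤ (ℤ.+ 2) * â * x j - â * S

    -- N (u_j² − (bS)²) is a combination of the three relations above.
    u²≈[bS]² : ∀ j → u j * u j ≈ (b̂ * S) * (b̂ * S)
    u²≈[bS]² j = x-y≈0⇒x≈y _ _ (cancelˡ-≉0 N≉0 (begin
      N * (u j * u j - (b̂ * S) * (b̂ * S))
        ≈⟨ solve 7 (λ X Y S T L A B →
             (S :* T) :* ((con (ℤ.+ 2) :* A :* X :- A :* S) :* (con (ℤ.+ 2) :* A :* X :- A :* S) :- (B :* S) :* (B :* S))
             := (con (ℤ.+ 4) :* (A :* A) :* (X :* S :- S :* S)) :* (X :* T :- X :* Y :+ L)
              :+ (:- (con (ℤ.+ 4) :* (A :* A) :* (X :* S))) :* (Y :* S :- X :* Y :+ L)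
              :+ (:- (S :* S)) :* (B :* B :* (S :* T) :- A :* A :* ((S :* T) :+ con (ℤ.+ 4) :* L)))
           refl (x j) (y j) S T L â b̂ ⟩
      P₁ * (x j * T - x j * y j + L) + P₂ * (y j * S - x j * y j + L) + P₃ * (b̂ * b̂ * N - â * â * (N + ιℤ (ℤ.+ 4) * L))
        ≈⟨ +-cong (+-cong (*-congˡ (x-relation j)) (*-congˡ (y-relation j))) (*-congˡ ratio-relation) ⟩
      P₁ * 0# + P₂ * 0# + P₃ * 0#
        ≈⟨ zero-combination P₁ P₂ P₃ ⟩
      0# ∎))
      where
      P₁ P₂ P₃ : Carrier
      P₁ = ιℤ (ℤ.+ 4) * (â * â) * (x j * S - S * S)
      P₂ = - (ιℤ (ℤ.+ 4) * (â * â) * (x j * S))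
      P₃ = - (S * S)

    -- abstract, so that checking plus? and u≈±bS does not unfold this proof term
    abstract
      sign : ∀ j → u j ≈ b̂ * S ⊎ u j ≈ - (b̂ * S)
      sign j = x²≈y²⇒x≈±y (u²≈[bS]² j)

    2â≉0 : ¬ (ιℤ (ℤ.+ 2) * â ≈ 0#)
    2â≉0 2â≈0 = ι-≉0 (ℕ.*-mono-< (ℕ.z<s {1}) a>0) (trans (ι-homo-* 2 a) 2â≈0)

    [b-a]xy≈[b+a]λ : ∀ j → u j ≈ b̂ * S → (b̂ - â) * (x j * y j) ≈ (b̂ + â) * L
    [b-a]xy≈[b+a]λ j u≈bS = x-y≈0⇒x≈y _ _ (cancelˡ-≉0 2â≉0 (begin
      ιℤ (ℤ.+ 2) * â * ((b̂ - â) * (x j * y j) - (b̂ + â) * L)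
        ≈⟨ solve 7 (λ X Y S T L A B →
             con (ℤ.+ 2) :* A :* ((B :- A) :* (X :* Y) :- (B :+ A) :* L)
             := (:- ((B :- A) :* (con (ℤ.+ 2) :* A))) :* (X :* T :- X :* Y :+ L)
                :+ ((B :- A) :* T) :* ((con (ℤ.+ 2) :* A :* X :- A :* S) :- B :* S)
                :+ con (ℤ.+ 1) :* (B :* B :* (S :* T) :- A :* A :* ((S :* T) :+ con (ℤ.+ 4) :* L)))
           refl (x j) (y j) S T L â b̂ ⟩
      _ ≈⟨ +-cong (+-cong (*-congˡ (x-relation j)) (*-congˡ (x≈y⇒x-y≈0 u≈bS))) (*-congˡ ratio-relation) ⟩
      _ * 0# + _ * 0# + _ * 0# ≈⟨ zero-combination _ _ _ ⟩
      0# ∎))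

    [b+a]xy≈[b-a]λ : ∀ j → u j ≈ - (b̂ * S) → (b̂ + â) * (x j * y j) ≈ (b̂ - â) * L
    [b+a]xy≈[b-a]λ j u≈-bS = x-y≈0⇒x≈y _ _ (cancelˡ-≉0 2â≉0 (begin
      ιℤ (ℤ.+ 2) * â * ((b̂ + â) * (x j * y j) - (b̂ - â) * L)
        ≈⟨ solve 7 (λ X Y S T L A B →
             con (ℤ.+ 2) :* A :* ((B :+ A) :* (X :* Y) :- (B :- A) :* L)
             := (:- ((B :+ A) :* (con (ℤ.+ 2) :* A))) :* (X :* T :- X :* Y :+ L)
                :+ ((B :+ A) :* T) :* ((con (ℤ.+ 2) :* A :* X :- A :* S) :- (:- (B :* S)))
                :+ (:- con (ℤ.+ 1)) :* (B :* B :* (S :* T) :- A :* A :* ((S :* T) :+ con (ℤ.+ 4) :* L)))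
           refl (x j) (y j) S T L â b̂ ⟩
      _ ≈⟨ +-cong (+-cong (*-congˡ (x-relation j)) (*-congˡ (x≈y⇒x-y≈0 u≈-bS))) (*-congˡ ratio-relation) ⟩
      _ * 0# + _ * 0# + _ * 0# ≈⟨ zero-combination _ _ _ ⟩
      0# ∎))

    plus? : Fin m → Bool
    plus? j with sign j
    ... | inj₁ _ = true
    ... | inj₂ _ = false

    u≈±bS : ∀ j → u j ≈ (if plus? j then b̂ * S else - (b̂ * S))
    u≈±bS j with sign j
    ... | inj₁ u≈bS  = u≈bS
    ... | inj₂ u≈-bS = u≈-bS

    u-plus : ∀ {j} → plus? j ≡ true → u j ≈ b̂ * S
    u-plus {j} plus = trans (u≈±bS j) (reflexive (≡.cong (λ t → if t then b̂ * S else - (b̂ * S)) plus))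

    u-minus : ∀ {j} → plus? j ≡ false → u j ≈ - (b̂ * S)
    u-minus {j} minus = trans (u≈±bS j) (reflexive (≡.cong (λ t → if t then b̂ * S else - (b̂ * S)) minus))

    module _ (a≤b : a ℕ.≤ b) where

      plus-case : ∀ {j} → plus? j ≡ true → ι (b ℕ.∸ a) * (x j * y j) ≈ ι ((b ℕ.+ a) ℕ.* lam)
      plus-case {j} plus = begin
        ι (b ℕ.∸ a) * (x j * y j)  ≈⟨ *-congʳ (ι-homo-∸ a≤b) ⟩
        (b̂ - â) * (x j * y j)      ≈⟨ [b-a]xy≈[b+a]λ j (u-plus plus) ⟩
        (b̂ + â) * L                ≈⟨ trans (ι-homo-* (b ℕ.+ a) lam) (*-congʳ (ι-homo-+ b a)) ⟨
        ι ((b ℕ.+ a) ℕ.* lam)      ∎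

      minus-case : ∀ {j} → plus? j ≡ false → ι (b ℕ.+ a) * (x j * y j) ≈ ι ((b ℕ.∸ a) ℕ.* lam)
      minus-case {j} minus = begin
        ι (b ℕ.+ a) * (x j * y j)  ≈⟨ *-congʳ (ι-homo-+ b a) ⟩
        (b̂ + â) * (x j * y j)      ≈⟨ [b+a]xy≈[b-a]λ j (u-minus minus) ⟩
        (b̂ - â) * L                ≈⟨ trans (ι-homo-* (b ℕ.∸ a) lam) (*-congʳ (ι-homo-∸ a≤b)) ⟨
        ι ((b ℕ.∸ a) ℕ.* lam)      ∎

    n₊ n₋ : ℕ
    n₊ = count plus?
    n₋ = count (not ∘ plus?)

    ∑u≈[2-m]aS : sum u ≈ ιℤ (ℤ.+ 2) * â * S - ι m * (â * S)
    ∑u≈[2-m]aS = begin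
      sum u                                                   ≈⟨ ∑-distrib-+ (λ j → ιℤ (ℤ.+ 2) * â * x j) (λ _ → - (â * S)) ⟩
      sum (λ j → ιℤ (ℤ.+ 2) * â * x j) + sum {m} (λ _ → - (â * S)) ≈⟨ +-cong (sym (*-distribˡ-sum (ιℤ (ℤ.+ 2) * â) x)) (∑-constant m _) ⟩
      ιℤ (ℤ.+ 2) * â * S + ι m * (- (â * S))                  ≈⟨ +-congˡ (-‿distribʳ-* _ _) ⟨
      ιℤ (ℤ.+ 2) * â * S - ι m * (â * S)                      ∎
      where open import Algebra.Properties.Ring ring using (-‿distribʳ-*)

    2a+n₋b≡n₊b+ma : 2 ℕ.* a ℕ.+ n₋ ℕ.* b ≡ n₊ ℕ.* b ℕ.+ m ℕ.* a
    2a+n₋b≡n₊b+ma = ι-injective _ _ (begin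
      ι (2 ℕ.* a ℕ.+ n₋ ℕ.* b)            ≈⟨ trans (ι-homo-+ (2 ℕ.* a) (n₋ ℕ.* b)) (+-cong (ι-homo-* 2 a) (ι-homo-* n₋ b)) ⟩
      ιℤ (ℤ.+ 2) * â + ι n₋ * b̂          ≈⟨ x-y≈0⇒x≈y _ _ (cancelˡ-≉0 S≉0 S[…]≈0) ⟩
      ι n₊ * b̂ + ι m * â                  ≈⟨ trans (ι-homo-+ (n₊ ℕ.* b) (m ℕ.* a)) (+-cong (ι-homo-* n₊ b) (ι-homo-* m a)) ⟨
      ι (n₊ ℕ.* b ℕ.+ m ℕ.* a)            ∎)
      where
      S[…]≈0 : S * (ιℤ (ℤ.+ 2) * â + ι n₋ * b̂ - (ι n₊ * b̂ + ι m * â)) ≈ 0#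
      S[…]≈0 = begin
        S * (ιℤ (ℤ.+ 2) * â + ι n₋ * b̂ - (ι n₊ * b̂ + ι m * â))
          ≈⟨ solve 6 (λ S A B p q M → S :* (con (ℤ.+ 2) :* A :+ q :* B :- (p :* B :+ M :* A))
                  := (con (ℤ.+ 2) :* A :* S :- M :* (A :* S)) :- (p :* (B :* S) :- q :* (B :* S))) refl S â b̂ (ι n₊) (ι n₋) (ι m) ⟩
        (ιℤ (ℤ.+ 2) * â * S - ι m * (â * S)) - (ι n₊ * (b̂ * S) - ι n₋ * (b̂ * S))
          ≈⟨ +-cong (sym ∑u≈[2-m]aS) (-‿cong (sym (trans (sum-cong-≋ u≈±bS) (∑-signed plus? (b̂ * S))))) ⟩
        sum u - sum u ≈⟨ -‿inverseʳ _ ⟩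
        0# ∎

-- Divisibility

open import Data.Nat using (_+_; _*_; _∸_; _<_; s≤s; z≤n; _%_; >-nonZero)
open import Data.Nat.Properties
open import Data.Nat.Divisibility
import Data.Nat.Coprimality as Coprimality
open Coprimality using (coprime-divisor; coprime-factors; coprime⇒gcd≡1)
open import Data.Nat.LCM using (lcm; lcm-least; gcd*lcm)
open import Data.Nat.Solver using (module +-*-Solver)
open ≡ using (refl)
open +-*-Solver

b*b∸a*a≡[b+a]*[b∸a] : ∀ a b → b * b ∸ a * a ≡ (b + a) * (b ∸ a)
b*b∸a*a≡[b+a]*[b∸a] a b = begin
  b * b ∸ a * a                       ≡⟨ [m+n]∸[m+o]≡n∸o (a * b) (b * b) (a * a) ⟨
  (a * b + b * b) ∸ (a * b + a * a)   ≡⟨ ≡.cong₂ _∸_ (+-comm (a * b) (b * b)) (≡.cong (_+ a * a) (*-comm a b)) ⟩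
  (b * b + a * b) ∸ (b * a + a * a)   ≡⟨ ≡.cong₂ _∸_ (*-distribʳ-+ b b a) (*-distribʳ-+ a b a) ⟨
  (b + a) * b ∸ (b + a) * a           ≡⟨ *-distribˡ-∸ (b + a) b a ⟨
  (b + a) * (b ∸ a)                   ∎
  where open ≡.≡-Reasoning

b+a≡[b∸a]+a*2 : ∀ {a b} → a ≤ b → b + a ≡ b ∸ a + a * 2
b+a≡[b∸a]+a*2 {a} {b} a≤b = ≡.trans (≡.cong (_+ a) (≡.sym (m∸n+n≡m a≤b))) (solve 2 (λ q a → (q :+ a) :+ a := q :+ a :* con 2) refl (b ∸ a) a)

[b+a]+[b∸a]≡b*2 : ∀ {a b} → a ≤ b → b + a + (b ∸ a) ≡ b * 2
[b+a]+[b∸a]≡b*2 {a} {b} a≤b = begin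
  b + a + (b ∸ a)               ≡⟨ ≡.cong (λ t → t + a + (b ∸ a)) (m∸n+n≡m a≤b) ⟨
  b ∸ a + a + a + (b ∸ a)       ≡⟨ solve 2 (λ q a → q :+ a :+ a :+ q := (q :+ a) :* con 2) refl (b ∸ a) a ⟩
  (b ∸ a + a) * 2               ≡⟨ ≡.cong (_* 2) (m∸n+n≡m a≤b) ⟩
  b * 2                         ∎
  where open ≡.≡-Reasoning

common-divisor∣2 : ∀ {a b d} → a ≤ b → Coprime a b → d ∣ b + a → d ∣ b ∸ a → d ∣ 2
common-divisor∣2 {a} {b} {d} a≤b a⊥b d∣b+a d∣b∸a = coprime-factors a⊥b (d∣a*2 , d∣b*2)
  where
  d∣a*2 : d ∣ a * 2
  d∣a*2 = ∣m+n∣m⇒∣n (≡.subst (d ∣_) (b+a≡[b∸a]+a*2 a≤b) d∣b+a) d∣b∸a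
  d∣b*2 : d ∣ b * 2
  d∣b*2 = ≡.subst (d ∣_) ([b+a]+[b∸a]≡b*2 a≤b) (∣m∣n⇒∣m+n d∣b+a d∣b∸a)

∣2⇒≡1⊎≡2 : ∀ {d} → d ∣ 2 → d ≡ 1 ⊎ d ≡ 2
∣2⇒≡1⊎≡2 {zero}              0∣2 = ⊥-elim (1+n≢0 (0∣⇒≡0 0∣2))
∣2⇒≡1⊎≡2 {suc zero}          _   = inj₁ refl
∣2⇒≡1⊎≡2 {suc (suc zero)}    _   = inj₂ refl
∣2⇒≡1⊎≡2 {suc (suc (suc d))} d∣2 = ⊥-elim (<⇒≱ (s≤s (s≤s (s≤s z≤n))) (∣⇒≤ d∣2))

coprime⇒*∣ : ∀ {m n o} → Coprime m n → m ∣ o → n ∣ o → m * n ∣ o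
coprime⇒*∣ {m} {n} m⊥n m∣o n∣o = ≡.subst (_∣ _) lcm≡m*n (lcm-least m∣o n∣o)
  where
  lcm≡m*n : lcm m n ≡ m * n
  lcm≡m*n = ≡.trans (≡.sym (*-identityˡ (lcm m n))) (≡.trans (≡.cong (_* lcm m n) (≡.sym (coprime⇒gcd≡1 m⊥n))) (gcd*lcm m n))

mutually-dividing-scaled⇒*∣ : ∀ {p q l} → Coprime p q → q ∣ p * l → p ∣ q * l → p * q ∣ l
mutually-dividing-scaled⇒*∣ p⊥q q∣pl p∣ql = coprime⇒*∣ p⊥q (coprime-divisor p⊥q p∣ql) (coprime-divisor (Coprimality.sym p⊥q) q∣pl)

module _ {a b l : ℕ} (a<b : a < b) (a⊥b : Coprime a b)
         (q∣pl : b ∸ a ∣ (b + a) * l) (p∣ql : b + a ∣ (b ∸ a) * l) where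
  private
    a≤b : a ≤ b
    a≤b = <⇒≤ a<b
    p q : ℕ
    p = b + a
    q = b ∸ a

  odd-sum⇒*∣ : ¬ (2 ∣ p) → p * q ∣ l
  odd-sum⇒*∣ 2∤p = mutually-dividing-scaled⇒*∣ p⊥q q∣pl p∣ql
    where
    p⊥q : Coprime p q
    p⊥q (d∣p , d∣q) with ∣2⇒≡1⊎≡2 (common-divisor∣2 a≤b a⊥b d∣p d∣q)
    ... | inj₁ d≡1 = d≡1
    ... | inj₂ refl = ⊥-elim (2∤p d∣p)

  even-sum⇒*∣ : 2 ∣ p → p * q ∣ 4 * l
  even-sum⇒*∣ 2∣p = ≡.subst (_∣ 4 * l) (≡.sym pq≡4p′q′) (*-monoʳ-∣ 4 (mutually-dividing-scaled⇒*∣ p′⊥q′ q′∣p′l p′∣q′l))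
    where
    2∣q : 2 ∣ q
    2∣q = ∣m+n∣m⇒∣n (≡.subst (2 ∣_) (≡.trans (b+a≡[b∸a]+a*2 a≤b) (+-comm q (a * 2))) 2∣p) (n∣m*n a)
    p′ = quotient 2∣p
    q′ = quotient 2∣q
    p≡p′*2 : p ≡ p′ * 2
    p≡p′*2 = m∣n⇒n≡quotient*m 2∣p
    q≡q′*2 : q ≡ q′ * 2
    q≡q′*2 = m∣n⇒n≡quotient*m 2∣q
    pq≡4p′q′ : p * q ≡ 4 * (p′ * q′)
    pq≡4p′q′ = ≡.trans (≡.cong₂ _*_ p≡p′*2 q≡q′*2) (solve 2 (λ x y → (x :* con 2) :* (y :* con 2) := con 4 :* (x :* y)) refl p′ q′)
    p′⊥q′ : Coprime p′ q′
    p′⊥q′ {d} (d∣p′ , d∣q′) = ∣1⇒≡1 (*-cancelʳ-∣ 2 (common-divisor∣2 a≤b a⊥b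
      (≡.subst (d * 2 ∣_) (≡.sym p≡p′*2) (*-monoˡ-∣ 2 d∣p′)) (≡.subst (d * 2 ∣_) (≡.sym q≡q′*2) (*-monoˡ-∣ 2 d∣q′))))
    halve : ∀ {x x′ y y′} → x ≡ x′ * 2 → y ≡ y′ * 2 → x ∣ y * l → x′ ∣ y′ * l
    halve {x} {x′} {y} {y′} x≡ y≡ x∣yl = *-cancelʳ-∣ 2 (≡.subst₂ _∣_ x≡ yl≡y′l*2 x∣yl)
      where
      yl≡y′l*2 : y * l ≡ y′ * l * 2
      yl≡y′l*2 = ≡.trans (≡.cong (_* l) y≡) (solve 2 (λ u l → (u :* con 2) :* l := (u :* l) :* con 2) refl y′ l)
    q′∣p′l : q′ ∣ p′ * l
    q′∣p′l = halve {y′ = p′} q≡q′*2 p≡p′*2 q∣pl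
    p′∣q′l : p′ ∣ q′ * l
    p′∣q′l = halve {y′ = q′} p≡p′*2 q≡q′*2 p∣ql

  square-difference-∣ : (b * b ∸ a * a) ∣ 4 * l × ((b + a) % 2 ≡ 1 → (b * b ∸ a * a) ∣ l)
  square-difference-∣ rewrite b*b∸a*a≡[b+a]*[b∸a] a b with 2 ∣? p
  ... | no 2∤p  = ∣n⇒∣m*n 4 (odd-sum⇒*∣ 2∤p) , λ _ → odd-sum⇒*∣ 2∤p
  ... | yes 2∣p = even-sum⇒*∣ 2∣p , λ p%2≡1 → ⊥-elim (0≢1+n (≡.trans (≡.sym (n∣m⇒m%n≡0 p 2 2∣p)) p%2≡1))

module SignBalance {m a b : ℕ} (n₊ n₋ : ℕ) (2<m : 2 < m) (n₊+n₋≡m : n₊ + n₋ ≡ m) (balance : 2 * a + n₋ * b ≡ n₊ * b + m * a) where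
  private
    m′ : ℕ
    m′ = m ∸ 2
    m≡2+m′ : m ≡ 2 + m′
    m≡2+m′ = ≡.sym (m+[n∸m]≡n (<⇒≤ 2<m))

  n₋b≡n₊b+m′a : n₋ * b ≡ n₊ * b + m′ * a
  n₋b≡n₊b+m′a = +-cancelˡ-≡ (2 * a) _ _ (begin
    2 * a + n₋ * b            ≡⟨ balance ⟩
    n₊ * b + m * a            ≡⟨ ≡.cong (λ t → n₊ * b + t * a) m≡2+m′ ⟩
    n₊ * b + (2 + m′) * a     ≡⟨ solve 4 (λ n b m a → n :* b :+ (con 2 :+ m) :* a := con 2 :* a :+ (n :* b :+ m :* a)) refl n₊ b m′ a ⟩
    2 * a + (n₊ * b + m′ * a) ∎)
    where open ≡.≡-Reasoning

  bm≡2bn₊+am′ : b * m ≡ 2 * b * n₊ + a * m′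
  bm≡2bn₊+am′ = begin
    b * m                        ≡⟨ ≡.cong (b *_) n₊+n₋≡m ⟨
    b * (n₊ + n₋)                ≡⟨ solve 3 (λ b x y → b :* (x :+ y) := x :* b :+ y :* b) refl b n₊ n₋ ⟩
    n₊ * b + n₋ * b              ≡⟨ ≡.cong (n₊ * b +_) n₋b≡n₊b+m′a ⟩
    n₊ * b + (n₊ * b + m′ * a)   ≡⟨ solve 4 (λ n b m a → n :* b :+ (n :* b :+ m :* a) := con 2 :* b :* n :+ a :* m) refl n₊ b m′ a ⟩
    2 * b * n₊ + a * m′          ∎
    where open ≡.≡-Reasoning

  sign-balance⇒∣ : Coprime a b → 2 * b ∣ b * m ∸ a * (m ∸ 2) × b ∣ m ∸ 2
  sign-balance⇒∣ a⊥b = 2b∣ , coprime-divisor (Coprimality.sym a⊥b) (≡.subst (b ∣_) (*-comm m′ a) b∣m′a)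
    where
    2b∣ : 2 * b ∣ b * m ∸ a * m′
    2b∣ = divides n₊ (≡.trans (≡.cong (_∸ a * m′) bm≡2bn₊+am′) (≡.trans (m+n∸n≡m (2 * b * n₊) (a * m′)) (*-comm (2 * b) n₊)))
    b∣m′a : b ∣ m′ * a
    b∣m′a = ∣m+n∣m⇒∣n (≡.subst (b ∣_) n₋b≡n₊b+m′a (n∣m*n n₋)) (n∣m*n n₊)

  sign-balance⇒n₊>0 : a < b → 0 < n₊
  sign-balance⇒n₊>0 a<b = n≢0⇒n>0 (λ n₊≡0 → <⇒≢ am′<bm (≡.sym (bm≡am′ n₊≡0)))
    where
    bm≡am′ : n₊ ≡ 0 → b * m ≡ a * m′
    bm≡am′ refl = ≡.trans bm≡2bn₊+am′ (≡.cong (_+ a * m′) (*-zeroʳ (2 * b)))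
    am′<bm : a * m′ < b * m
    am′<bm = begin-strict
      a * m′         ≤⟨ *-monoˡ-≤ m′ (<⇒≤ a<b) ⟩
      b * m′         <⟨ m<m+n (b * m′) (*-monoʳ-< 2 (≤-<-trans z≤n a<b)) ⟩
      b * m′ + 2 * b ≡⟨ solve 2 (λ b m → b :* m :+ con 2 :* b := b :* (con 2 :+ m)) refl b m′ ⟩
      b * (2 + m′)   ≡⟨ ≡.cong (b *_) m≡2+m′ ⟨
      b * m          ∎
      where open ≤-Reasoning

  sign-balance⇒n₋>0 : 0 < a → 0 < n₋
  sign-balance⇒n₋>0 a>0 = n≢0⇒n>0 (λ n₋≡0 → <⇒≱ 2a<n₊b+ma (≤-reflexive (≡.sym (2a≡n₊b+ma n₋≡0))))
    where
    2a≡n₊b+ma : n₋ ≡ 0 → 2 * a ≡ n₊ * b + m * a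
    2a≡n₊b+ma refl = ≡.trans (≡.sym (+-identityʳ (2 * a))) balance
    instance _ = >-nonZero a>0
    2a<n₊b+ma : 2 * a < n₊ * b + m * a
    2a<n₊b+ma = begin-strict
      2 * a            <⟨ *-monoˡ-< a (n<1+n 2) ⟩
      3 * a            ≤⟨ *-monoˡ-≤ a 2<m ⟩
      m * a            ≤⟨ m≤n+m (m * a) (n₊ * b) ⟩
      n₊ * b + m * a   ∎
      where open ≤-Reasoning

lemma5p1 : (G : FinAbGroup) (R : CommutativeRing 0ℓ 0ℓ) → IsChar0Domain R →
    (m k lam : ℕ) (D : Fin m → List (FinAbGroup.Carrier G)) →
    IsSEDF G m k lam D → 1 < k → 2 < m →
    (χ : FinAbGroup.Carrier G → CommutativeRing.Carrier R) →
    IsCharacter G R χ → Nonprincipal G R χ →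
    ¬ (CommutativeRing._≈_ R (χsum G R χ (union G m D)) (CommutativeRing.0# R)) →
    (a b : ℕ) → 0 < a → a < b → Coprime a b →
    CommutativeRing._≈_ R
      (CommutativeRing._*_ R (fromℕ R (b * b)) (normSq G R χ (union G m D)))
      (CommutativeRing._*_ R (fromℕ R (a * a))
        (CommutativeRing._+_ R (normSq G R χ (union G m D)) (fromℕ R (4 * lam)))) →
    ((2 * b) ∣ (b * m ∸ a * (m ∸ 2)) × b ∣ (m ∸ 2))
    × ((b ∸ a) ∣ ((b + a) * lam) × (b + a) ∣ ((b ∸ a) * lam))
    × ((b * b ∸ a * a) ∣ (4 * lam) × ((b + a) % 2 ≡ 1 → (b * b ∸ a * a) ∣ lam))
lemma5p1 G R domain m k lam D sedf _ 2<m χ isχ nonprincipal χ[D]≉0 a b a>0 a<b a⊥b ratio =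
  sign-balance⇒∣ a⊥b , (q∣pλ , p∣qλ) , square-difference-∣ a<b a⊥b q∣pλ p∣qλ
  where
  open Characters G R domain
  open SEDFCharacterSums isχ nonprincipal sedf
  open SignChoice.Signs R domain lam a b x y x-equation y-equation (normSq→∑x*∑y ratio) (∑x≉0 χ[D]≉0) a>0 (IsSEDF.lam≥1 sedf)
  open SignBalance n₊ n₋ 2<m (count+count-not≡size plus?) 2a+n₋b≡n₊b+ma
  plus-witness : Σ[ j ∈ Fin m ] plus? j ≡ true
  plus-witness = count>0⇒witness plus? (sign-balance⇒n₊>0 a<b)
  minus-witness : Σ[ j ∈ Fin m ] not (plus? j) ≡ true
  minus-witness = count>0⇒witness (not ∘ plus?) (sign-balance⇒n₋>0 a>0)
  q∣pλ : b ∸ a ∣ (b + a) * lam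
  q∣pλ = x*y-integral (proj₁ plus-witness) (m<n⇒0<n∸m a<b) (plus-case (<⇒≤ a<b) (proj₂ plus-witness))
  p∣qλ : b + a ∣ (b ∸ a) * lam
  p∣qλ = x*y-integral (proj₁ minus-witness) (<-≤-trans a>0 (m≤n+m a b)) (minus-case (<⇒≤ a<b) (not-injective (proj₂ minus-witness)))
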